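{- Let $n \geq 2$ be an integer and let $p$ be a positive odd integer with $p < 2n-2$. Then there exists a quadrangular embedding of $G(3, 2n, 2)$ in which the two unsaturated black vertices are separated by exactly $p$ vertices in the rotation of the unique saturated white vertex.
   Context: For nonnegative integers $m,n,k$ with $k \le \min(m,n)$, $G(m,n,k)$ denotes the graph obtained from the complete bipartite graph $K_{m,n}$ (with $m$ white and $n$ black vertices) by deleting $k$ pairwise independent edges. A vertex is saturated if it is adjacent to every vertex of the other color, and unsaturated otherwise; in $G(3,2n,2)$ exactly one white vertex and $2n-2$ black vertices are saturated. A quadrangular embedding is a cellular embedding in a closed surface (every face an open disk) in which every face is bounded by a closed walk of length 4. The rotation of a vertex $v$ in an embedding is the cyclic order of its neighbors around $v$ (for simple graphs); two neighbors $i,j$ of $v$ are separated by $p$ vertices in the rotation of $v$ if, going around this cyclic order from $i$ to $j$ in one of the two directions, exactly $p$ other neighbors of $v$ are passed. -}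

module Defs where

open import Data.Nat using (ℕ; zero; suc; _<_; _*_; _+_)
open import Data.Fin using (Fin; toℕ)
open import Data.Bool using (Bool; true; false; if_then_else_; _xor_)
open import Data.Sum using (_⊎_; inj₁; inj₂)
open import Data.Product using (_×_; _,_; ∃)
open import Data.Empty using (⊥)
open import Relation.Nullary using (¬_)
open import Relation.Binary.PropositionalEquality using (_≡_; _≢_)

iter : {A : Set} → (A → A) → ℕ → A → A
iter f zero    x = x
iter f (suc k) x = f (iter f k x)

-- The graph G(3, 2n, 2)
-- white vertices: inj₁ i, i : Fin 3;  black vertices: inj₂ j, j : Fin (2n).
-- Deleted (independent) edges: white 0 -- black 0 and white 1 -- black 1.
-- Hence white 2 is the unique saturated white vertex and black 0, black 1
-- are the two unsaturated black vertices.

Vtx : ℕ → Set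
Vtx n = Fin 3 ⊎ Fin (2 * n)

Deleted : ∀ {n} → Fin 3 → Fin (2 * n) → Set
Deleted i j = (toℕ i ≡ toℕ j) × (toℕ i < 2)

Adj : ∀ n → Vtx n → Vtx n → Set
Adj n (inj₁ i) (inj₁ i') = ⊥
Adj n (inj₁ i) (inj₂ j)  = ¬ Deleted {n} i j
Adj n (inj₂ j) (inj₁ i)  = ¬ Deleted {n} i j
Adj n (inj₂ j) (inj₂ j') = ⊥

-- General rotation systems (rotation at each vertex + edge signatures);
-- these correspond exactly to cellular embeddings of a connected graph in
-- closed surfaces (orientable or not).
-- rot u v  : successor of neighbour v in the rotation (cyclic order) at u
-- rot⁻ u v : predecessor of v in the rotation at u
-- sig u v  : true iff the edge uv is twisted (signature -1)

record RotSys (V : Set) (A : V → V → Set) : Set where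
  field
    rot  : V → V → V
    rot⁻ : V → V → V
    sig  : V → V → Bool
    rot-adj    : ∀ u v → A u v → A u (rot u v)
    rot⁻-adj   : ∀ u v → A u v → A u (rot⁻ u v)
    rot-rot⁻   : ∀ u v → A u v → rot u (rot⁻ u v) ≡ v
    rot⁻-rot   : ∀ u v → A u v → rot⁻ u (rot u v) ≡ v
    rot-cyclic : ∀ u v w → A u v → A u w → ∃ λ k → iter (rot u) k v ≡ w
    sig-sym    : ∀ u v → A u v → sig u v ≡ sig v u

  -- Face-tracing: a state (u , v , ε) is the dart u→v traversed with
  -- current local orientation ε (false = unchanged, true = reversed).
  faceStep : V × V × Bool → V × V × Bool
  faceStep (u , v , ε) =
    let ε' = ε xor sig u v in
    (v , (if ε' then rot⁻ v u else rot v u) , ε')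

  Quadrangular : Set
  Quadrangular = ∀ u v ε → A u v →
    (iter faceStep 4 (u , v , ε) ≡ (u , v , ε)) ×
    (∀ k → 0 < k → k < 4 → iter faceStep k (u , v , ε) ≢ (u , v , ε))

SeparatedBy : ∀ {V A} → RotSys V A → V → V → V → ℕ → Set
SeparatedBy R x y z p =
  (iter (RotSys.rot R x) (suc p) y ≡ z) ⊎ (iter (RotSys.rot R x) (suc p) z ≡ y)

open import Data.Fin using (fromℕ<)
open import Data.Nat using (_≤_)
open import Data.Nat.Properties using (≤-trans; m≤m+n; +-monoʳ-≤)

2≤2n : ∀ {n} → 2 ≤ n → 2 ≤ 2 * n
2≤2n {n} h = ≤-trans h (m≤m+n n (n + 0))

black : ∀ n (j : ℕ) → j < 2 * n → Vtx n
black n j h = inj₂ (fromℕ< h)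

white : ∀ n → Fin 3 → Vtx n
white n i = inj₁ i

open import Data.Nat using (s≤s; z≤n)
unsatBlack₀ unsatBlack₁ : ∀ n → 2 ≤ n → Vtx n
unsatBlack₀ n h = black n 0 (≤-trans (s≤s z≤n) (2≤2n h))
unsatBlack₁ n h = black n 1 (2≤2n h)

module Submission where

-- Every face of such an embedding is a quadrangle w x t y with white w, t and black x, y, so the
-- embedding is determined by cyclic orders of the black neighbours around the white vertices
-- A, B, C (each saturated black vertex seeing A, B, C in this order) and by edge twists, and it is
-- quadrangular when each corner {x, y} of consecutive neighbours around one white vertex is also a
-- corner at one other white vertex. We choose orders in which U₀ and U₁ are separated around the
-- saturated vertex C by any prescribed odd number 2k + 1 < 2n − 2 of vertices, and twists that
-- alternate along each white rotation. A face through two saturated black vertices then closes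
-- after four steps by this corner sharing, the four faces through U₀ or U₁ are computed directly,
-- and faces need only be traced from white vertices because the reverse of a closed face is
-- closed. For n = 2 the pattern degenerates and the embedding is checked by evaluation.

open import Defs
open import Data.Nat using (ℕ; _≤_; _<_; _∸_; _*_)
open import Data.Nat.Properties using ()
open import Data.Fin using (Fin; zero; suc; #_)
open import Data.Sum using (_⊎_; inj₁; inj₂)
open import Data.Product using (Σ; _×_; _,_)
open import Relation.Binary.PropositionalEquality using (_≡_)
open import Relation.Nullary using (¬_)

open import Data.Nat using (zero; suc; _+_; z≤n; s≤s; _≡ᵇ_; _<ᵇ_; _≤ᵇ_; _≤?_; _<?_; ⌊_/2⌋)
open import Data.Nat.Properties
open import Data.Fin using (toℕ)
open import Data.Fin.Properties using (toℕ<n; all?; any?) renaming (_≟_ to _≟ᶠ_)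
open import Data.Bool using (Bool; true; false; not; _xor_; _∨_; if_then_else_)
open import Data.Bool.Properties
  using (not-involutive; not-injective; xor-same; xor-assoc; xor-identityʳ; xor-inverseˡ; xor-inverseʳ; not-distribˡ-xor)
import Data.Bool.Properties as Bool
open import Data.Unit using (⊤; tt)
open import Data.Empty using (⊥; ⊥-elim)
open import Data.List using (List; []; _∷_)
import Data.List as List
open import Data.Product using (∃; proj₁; proj₂)
import Data.Product.Properties as Product
open import Data.Sum using (swap)
import Data.Sum.Properties as Sum
open import Function using (_∘_)
open import Relation.Nullary using (Dec; does; yes; no; ¬?)
open import Relation.Nullary.Decidable using (dec-true; dec-false; _×-dec_; _→-dec_; map′; from-yes)
open import Relation.Binary.Definitions using (tri<; tri≈; tri>)
open import Relation.Binary.PropositionalEquality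
  using (_≢_; refl; sym; trans; cong; cong₂; subst; subst₂; module ≡-Reasoning)

iter-+ : ∀ {A : Set} (f : A → A) m n x → iter f (m + n) x ≡ iter f m (iter f n x)
iter-+ f zero    n x = refl
iter-+ f (suc m) n x = cong f (iter-+ f m n x)

iter-sucʳ : ∀ {A : Set} (f : A → A) n x → iter f (suc n) x ≡ iter f n (f x)
iter-sucʳ f zero    x = refl
iter-sucʳ f (suc n) x = cong f (iter-sucʳ f n x)

xor-cancelʳ : ∀ a b → (a xor b) xor b ≡ a
xor-cancelʳ a b = trans (xor-assoc a b b) (trans (cong (a xor_) (xor-same b)) (xor-identityʳ a))

xor-xor-not : ∀ a b → (a xor b) xor not b ≡ not a
xor-xor-not false false = refl
xor-xor-not false true  = refl
xor-xor-not true  false = refl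
xor-xor-not true  true  = refl

-- the rank counts the steps from base, so r runs through all of N in a single cycle
record RankedCycle {V : Set} (N : V → Set) (r r⁻ : V → V) : Set where
  field
    r-closed   : ∀ x → N x → N (r x)
    r⁻-closed  : ∀ x → N x → N (r⁻ x)
    r-r⁻       : ∀ x → N x → r (r⁻ x) ≡ x
    r⁻-r       : ∀ x → N x → r⁻ (r x) ≡ x
    base       : V
    rank       : V → ℕ
    rank-step  : ∀ x → N x → r x ≡ base ⊎ rank (r x) ≡ suc (rank x)
    bound      : ℕ
    rank-bound : ∀ x → N x → rank x < bound

  reached-from-base : ∀ w → N w → ∃ λ k → iter r k base ≡ w
  reached-from-base w nw = go (rank w) w nw refl
    where
    go : ∀ n w → N w → rank w ≡ n → ∃ λ k → iter r k base ≡ w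
    go n w nw rank≡n with rank-step (r⁻ w) (r⁻-closed w nw) | r-r⁻ w nw
    ... | inj₁ hit | back = 0 , trans (sym hit) back
    go zero    w nw rank≡n | inj₂ up | back =
      ⊥-elim (0≢1+n (trans (sym rank≡n) (trans (cong rank (sym back)) up)))
    go (suc n) w nw rank≡n | inj₂ up | back
      with go n (r⁻ w) (r⁻-closed w nw) (suc-injective (trans (sym up) (trans (cong rank back) rank≡n)))
    ... | k , reach = suc k , trans (cong r reach) back

  reaches-base : ∀ fuel v → N v → bound ≤ rank v + fuel → ∃ λ k → iter r k v ≡ base
  reaches-base fuel v nv enough with rank-step v nv
  ... | inj₁ hit = 1 , hit
  reaches-base zero v nv enough | inj₂ _ =
    ⊥-elim (<⇒≱ (rank-bound v nv) (subst (bound ≤_) (+-identityʳ _) enough))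
  reaches-base (suc fuel) v nv enough | inj₂ up
    with reaches-base fuel (r v) (r-closed v nv)
           (subst (bound ≤_) (trans (+-suc _ fuel) (cong (_+ fuel) (sym up))) enough)
  ... | k , reach = suc k , trans (iter-sucʳ r k v) reach

  cyclic : ∀ v w → N v → N w → ∃ λ k → iter r k v ≡ w
  cyclic v w nv nw with reaches-base bound v nv (m≤n+m bound (rank v)) | reached-from-base w nw
  ... | k₁ , e₁ | k₂ , e₂ = k₂ + k₁ , trans (iter-+ r k₂ k₁ v) (trans (cong (iter r k₂) e₁) e₂)

module FaceTracing {V : Set} {E : V → V → Set} (R : RotSys V E) (E-sym : ∀ u v → E u v → E v u) where
  open RotSys R

  State : Set
  State = V × V × Bool

  OnEdge : State → Set
  OnEdge (u , v , _) = E u v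

  QuadrangularAt : State → Set
  QuadrangularAt s = (iter faceStep 4 s ≡ s) × (∀ k → 0 < k → k < 4 → iter faceStep k s ≢ s)

  arrive : V → V → Bool → State
  arrive v u η = (v , (if η then rot⁻ v u else rot v u) , η)

  arrive-onEdge : ∀ u v η → E v u → OnEdge (arrive v u η)
  arrive-onEdge u v false e = rot-adj v u e
  arrive-onEdge u v true  e = rot⁻-adj v u e

  iter-faceStep-onEdge : ∀ k s → OnEdge s → OnEdge (iter faceStep k s)
  iter-faceStep-onEdge zero s e = e
  iter-faceStep-onEdge (suc k) s e with iter faceStep k s | iter-faceStep-onEdge k s e
  ... | (u , v , ε) | e′ = arrive-onEdge u v (ε xor sig u v) (E-sym u v e′)

  reverse : State → State
  reverse (u , v , ε) = (v , u , not ε xor sig u v)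

  reverse-involutive : ∀ s → OnEdge s → reverse (reverse s) ≡ s
  reverse-involutive (u , v , ε) e = cong (λ δ → (u , v , δ)) (begin
    not (not ε xor sig u v) xor sig v u
      ≡⟨ cong₂ _xor_ (not-distribˡ-xor (not ε) (sig u v)) (sym (sig-sym u v e)) ⟩
    (not (not ε) xor sig u v) xor sig u v   ≡⟨ xor-cancelʳ (not (not ε)) (sig u v) ⟩
    not (not ε)                             ≡⟨ not-involutive ε ⟩
    ε                                       ∎)
    where open ≡-Reasoning

  faceStep-reverse-arrive : ∀ u v η → E v u → faceStep (reverse (arrive v u η)) ≡ (v , u , not η)
  faceStep-reverse-arrive u v false e
    rewrite sig-sym (rot v u) v (E-sym _ _ (rot-adj v u e)) | xor-inverseˡ (sig v (rot v u)) | rot⁻-rot v u e = refl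
  faceStep-reverse-arrive u v true e
    rewrite sig-sym (rot⁻ v u) v (E-sym _ _ (rot⁻-adj v u e)) | xor-same (sig v (rot⁻ v u)) | rot-rot⁻ v u e = refl

  faceStep-reverse-faceStep : ∀ s → OnEdge s → faceStep (reverse (faceStep s)) ≡ reverse s
  faceStep-reverse-faceStep (u , v , ε) e =
    trans (faceStep-reverse-arrive u v (ε xor sig u v) (E-sym u v e))
          (cong (λ δ → (v , u , δ)) (not-distribˡ-xor ε (sig u v)))

  iter-reverse : ∀ k s → OnEdge s → iter faceStep k (reverse (iter faceStep k s)) ≡ reverse s
  iter-reverse zero    s e = refl
  iter-reverse (suc k) s e = begin
    iter faceStep (suc k) (reverse (faceStep (iter faceStep k s)))
      ≡⟨ iter-sucʳ faceStep k (reverse (faceStep (iter faceStep k s))) ⟩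
    iter faceStep k (faceStep (reverse (faceStep (iter faceStep k s))))
      ≡⟨ cong (iter faceStep k) (faceStep-reverse-faceStep (iter faceStep k s) (iter-faceStep-onEdge k s e)) ⟩
    iter faceStep k (reverse (iter faceStep k s))
      ≡⟨ iter-reverse k s e ⟩
    reverse s ∎
    where open ≡-Reasoning

  faceStep-injective : ∀ s t → OnEdge s → OnEdge t → faceStep s ≡ faceStep t → s ≡ t
  faceStep-injective s t es et eq = begin
    s                              ≡⟨ sym (reverse-involutive s es) ⟩
    reverse (reverse s)            ≡⟨ cong reverse (sym (faceStep-reverse-faceStep s es)) ⟩
    reverse (faceStep (reverse (faceStep s))) ≡⟨ cong (λ u → reverse (faceStep (reverse u))) eq ⟩
    reverse (faceStep (reverse (faceStep t))) ≡⟨ cong reverse (faceStep-reverse-faceStep t et) ⟩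
    reverse (reverse t)            ≡⟨ reverse-involutive t et ⟩
    t                              ∎
    where open ≡-Reasoning

  iter-faceStep-injective : ∀ k s t → OnEdge s → OnEdge t → iter faceStep k s ≡ iter faceStep k t → s ≡ t
  iter-faceStep-injective zero    s t es et eq = eq
  iter-faceStep-injective (suc k) s t es et eq = iter-faceStep-injective k s t es et
    (faceStep-injective _ _ (iter-faceStep-onEdge k s es) (iter-faceStep-onEdge k t et) eq)

  -- closing up in four steps is a property of the whole orbit, since faceStep is injective
  returns-from-later : ∀ k s → OnEdge s → iter faceStep 4 (iter faceStep k s) ≡ iter faceStep k s →
    iter faceStep 4 s ≡ s
  returns-from-later k s e back = iter-faceStep-injective k _ s (iter-faceStep-onEdge 4 s e) e (begin
    iter faceStep k (iter faceStep 4 s) ≡⟨ sym (iter-+ faceStep k 4 s) ⟩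
    iter faceStep (k + 4) s             ≡⟨ cong (λ n → iter faceStep n s) (+-comm k 4) ⟩
    iter faceStep (4 + k) s             ≡⟨ iter-+ faceStep 4 k s ⟩
    iter faceStep 4 (iter faceStep k s) ≡⟨ back ⟩
    iter faceStep k s                   ∎)
    where open ≡-Reasoning

  quadrangularAt : ∀ {s} → iter faceStep 4 s ≡ s → faceStep s ≢ s → iter faceStep 2 s ≢ s → QuadrangularAt s
  quadrangularAt {s} back ¬one ¬two = back , early
    where
    early : ∀ k → 0 < k → k < 4 → iter faceStep k s ≢ s
    early 1 _ _ = ¬one
    early 2 _ _ = ¬two
    early 3 _ _ three = ¬one (trans (cong faceStep (sym three)) back)
    early (suc (suc (suc (suc _)))) _ (s≤s (s≤s (s≤s (s≤s ()))))

  quadrangularAt-reverse : ∀ s → OnEdge s → QuadrangularAt s → QuadrangularAt (reverse s)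
  quadrangularAt-reverse s e (back , early) = back′ , early′
    where
    back′ : iter faceStep 4 (reverse s) ≡ reverse s
    back′ = trans (cong (λ t → iter faceStep 4 (reverse t)) (sym back)) (iter-reverse 4 s e)

    -- k steps back along the reversed face are 4 − k steps forward along the original one
    mirror : ∀ k k′ → k + k′ ≡ 4 → 0 < k′ → k′ < 4 → iter faceStep k (reverse s) ≢ reverse s
    mirror k k′ sum 0<k′ k′<4 loop = early k′ 0<k′ k′<4 (begin
      iter faceStep k′ s
        ≡⟨ sym (reverse-involutive _ onEdge′) ⟩
      reverse (reverse (iter faceStep k′ s))
        ≡⟨ cong reverse (sym (iter-reverse k _ onEdge′)) ⟩
      reverse (iter faceStep k (reverse (iter faceStep k (iter faceStep k′ s))))
        ≡⟨ cong (λ t → reverse (iter faceStep k (reverse t))) full-turn ⟩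
      reverse (iter faceStep k (reverse s))
        ≡⟨ cong reverse loop ⟩
      reverse (reverse s)
        ≡⟨ reverse-involutive s e ⟩
      s ∎)
      where
      open ≡-Reasoning
      onEdge′ = iter-faceStep-onEdge k′ s e
      full-turn : iter faceStep k (iter faceStep k′ s) ≡ s
      full-turn = trans (sym (iter-+ faceStep k k′ s)) (trans (cong (λ m → iter faceStep m s) sum) back)

    early′ : ∀ k → 0 < k → k < 4 → iter faceStep k (reverse s) ≢ reverse s
    early′ 1 _ _ = mirror 1 3 refl (s≤s z≤n) (s≤s (s≤s (s≤s (s≤s z≤n))))
    early′ 2 _ _ = mirror 2 2 refl (s≤s z≤n) (s≤s (s≤s (s≤s z≤n)))
    early′ 3 _ _ = mirror 3 1 refl (s≤s z≤n) (s≤s (s≤s z≤n))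
    early′ (suc (suc (suc (suc _)))) _ (s≤s (s≤s (s≤s (s≤s ()))))

  quadrangular-from : (S : V → Set) → (∀ u v → E u v → S u ⊎ S v) →
    (∀ u v ε → S u → E u v → QuadrangularAt (u , v , ε)) → Quadrangular
  quadrangular-from S cover at-S u v ε e with cover u v e
  ... | inj₁ Su = at-S u v ε Su e
  ... | inj₂ Sv = subst QuadrangularAt (reverse-involutive (u , v , ε) e)
    (quadrangularAt-reverse _ (E-sym u v e) (at-S v u (not ε xor sig u v) Sv (E-sym u v e)))

module Pullback {V V′ : Set} (E : V → V → Set) (E′ : V′ → V′ → Set)
  (f : V → V′) (g : V′ → V) (g∘f : ∀ v → g (f v) ≡ v) (f∘g : ∀ x y → E′ x y → f (g y) ≡ y)
  (E⇒E′ : ∀ u v → E u v → E′ (f u) (f v)) (E′⇒E : ∀ u v → E′ (f u) (f v) → E u v)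
  (E-sym : ∀ u v → E u v → E v u) (R′ : RotSys V′ E′) where

  private module R′ = RotSys R′

  f-injective : ∀ {u v} → f u ≡ f v → u ≡ v
  f-injective {u} {v} eq = trans (sym (g∘f u)) (trans (cong g eq) (g∘f v))

  rot rot⁻ : V → V → V
  rot u v = g (R′.rot (f u) (f v))
  rot⁻ u v = g (R′.rot⁻ (f u) (f v))

  f-rot : ∀ u v → E u v → f (rot u v) ≡ R′.rot (f u) (f v)
  f-rot u v e = f∘g (f u) _ (R′.rot-adj (f u) (f v) (E⇒E′ u v e))

  f-rot⁻ : ∀ u v → E u v → f (rot⁻ u v) ≡ R′.rot⁻ (f u) (f v)
  f-rot⁻ u v e = f∘g (f u) _ (R′.rot⁻-adj (f u) (f v) (E⇒E′ u v e))

  rot-adj : ∀ u v → E u v → E u (rot u v)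
  rot-adj u v e = E′⇒E u _ (subst (E′ (f u)) (sym (f-rot u v e)) (R′.rot-adj (f u) (f v) (E⇒E′ u v e)))

  rot⁻-adj : ∀ u v → E u v → E u (rot⁻ u v)
  rot⁻-adj u v e = E′⇒E u _ (subst (E′ (f u)) (sym (f-rot⁻ u v e)) (R′.rot⁻-adj (f u) (f v) (E⇒E′ u v e)))

  iter-rot : ∀ k u v → E u v → f (iter (rot u) k v) ≡ iter (R′.rot (f u)) k (f v) × E u (iter (rot u) k v)
  iter-rot zero    u v e = refl , e
  iter-rot (suc k) u v e with iter-rot k u v e
  ... | eq , e′ = trans (f-rot u _ e′) (cong (R′.rot (f u)) eq) , rot-adj u _ e′

  R : RotSys V E
  R = record
    { rot = rot ; rot⁻ = rot⁻ ; sig = λ u v → R′.sig (f u) (f v)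
    ; rot-adj = rot-adj ; rot⁻-adj = rot⁻-adj
    ; rot-rot⁻ = λ u v e → f-injective (trans (f-rot u _ (rot⁻-adj u v e))
        (trans (cong (R′.rot (f u)) (f-rot⁻ u v e)) (R′.rot-rot⁻ (f u) (f v) (E⇒E′ u v e))))
    ; rot⁻-rot = λ u v e → f-injective (trans (f-rot⁻ u _ (rot-adj u v e))
        (trans (cong (R′.rot⁻ (f u)) (f-rot u v e)) (R′.rot⁻-rot (f u) (f v) (E⇒E′ u v e))))
    ; rot-cyclic = λ u v w e e′ → let (k , eq) = R′.rot-cyclic (f u) (f v) (f w) (E⇒E′ u v e) (E⇒E′ u w e′)
                                  in k , f-injective (trans (proj₁ (iter-rot k u v e)) eq)
    ; sig-sym = λ u v e → R′.sig-sym (f u) (f v) (E⇒E′ u v e)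
    }

  private
    module F = FaceTracing R E-sym

    f³ : F.State → V′ × V′ × Bool
    f³ (u , v , ε) = (f u , f v , ε)

    f³-injective : ∀ {s t} → f³ s ≡ f³ t → s ≡ t
    f³-injective {u , v , ε} {u′ , v′ , ε′} eq =
      cong₂ _,_ (f-injective (cong proj₁ eq))
                (cong₂ _,_ (f-injective (cong (proj₁ ∘ proj₂) eq)) (cong (proj₂ ∘ proj₂) eq))

    f³-faceStep : ∀ s → F.OnEdge s → f³ (RotSys.faceStep R s) ≡ R′.faceStep (f³ s)
    f³-faceStep (u , v , ε) e with ε xor R′.sig (f u) (f v)
    ... | true  = cong (λ z → (f v , z , true)) (f-rot⁻ v u (E-sym u v e))
    ... | false = cong (λ z → (f v , z , false)) (f-rot v u (E-sym u v e))

    f³-iter : ∀ k s → F.OnEdge s → f³ (iter (RotSys.faceStep R) k s) ≡ iter R′.faceStep k (f³ s)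
    f³-iter zero    s e = refl
    f³-iter (suc k) s e =
      trans (f³-faceStep (iter (RotSys.faceStep R) k s) (F.iter-faceStep-onEdge k s e))
            (cong R′.faceStep (f³-iter k s e))

  quadrangular : RotSys.Quadrangular R′ → RotSys.Quadrangular R
  quadrangular Q u v ε e with Q (f u) (f v) ε (E⇒E′ u v e)
  ... | back , early = f³-injective (trans (f³-iter 4 (u , v , ε) e) back) ,
                       λ k 0<k k<4 loop → early k 0<k k<4 (trans (sym (f³-iter k (u , v , ε) e)) (cong f³ loop))

  separatedBy : ∀ x y z p → E x y → E x z → SeparatedBy R′ (f x) (f y) (f z) p → SeparatedBy R x y z p
  separatedBy x y z p e e′ (inj₁ eq) = inj₁ (f-injective (trans (proj₁ (iter-rot (suc p) x y e)) eq))
  separatedBy x y z p e e′ (inj₂ eq) = inj₂ (f-injective (trans (proj₁ (iter-rot (suc p) x z e′)) eq))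

if-true : ∀ {A : Set} {c : Bool} {x y : A} → c ≡ true → (if c then x else y) ≡ x
if-true refl = refl

if-false : ∀ {A : Set} {c : Bool} {x y : A} → c ≡ false → (if c then x else y) ≡ y
if-false refl = refl

≡ᵇ-refl : ∀ i → (i ≡ᵇ i) ≡ true
≡ᵇ-refl i = dec-true (i ≟ i) refl

≢⇒≡ᵇ-false : ∀ {i j} → i ≢ j → (i ≡ᵇ j) ≡ false
≢⇒≡ᵇ-false {i} {j} = dec-false (i ≟ j)

<ᵇ-true : ∀ {i j} → i < j → (i <ᵇ j) ≡ true
<ᵇ-true {i} {j} = dec-true (i <? j)

<ᵇ-false : ∀ {i j} → j ≤ i → (i <ᵇ j) ≡ false
<ᵇ-false {i} {j} le = dec-false (i <? j) (≤⇒≯ le)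

≤ᵇ-true : ∀ {i j} → i ≤ j → (i ≤ᵇ j) ≡ true
≤ᵇ-true {i} {j} = dec-true (i ≤? j)

≤ᵇ-false : ∀ {i j} → j < i → (i ≤ᵇ j) ≡ false
≤ᵇ-false {i} {j} lt = dec-false (i ≤? j) (<⇒≱ lt)

≢0⇒suc : ∀ {n} → n ≢ 0 → ∃ λ n′ → n ≡ suc n′
≢0⇒suc {zero}  ne = ⊥-elim (ne refl)
≢0⇒suc {suc n} _  = n , refl

data White : Set where
  A B C : White

next prev : White → White
next A = B
next B = C
next C = A
prev A = C
prev B = A
prev C = B

data Node : Set where
  wh    : White → Node
  U₀ U₁ : Node
  D     : ℕ → Bool → Node

IsD : Node → Set
IsD (D _ _) = ⊤
IsD _       = ⊥

IsWhite : Node → Set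
IsWhite (wh _) = ⊤
IsWhite _      = ⊥

turn : White → Bool → White
turn w false = next w
turn w true  = prev w

turn-turn-not : ∀ w η → turn (turn w η) (not η) ≡ w
turn-turn-not A false = refl
turn-turn-not A true  = refl
turn-turn-not B false = refl
turn-turn-not B true  = refl
turn-turn-not C false = refl
turn-turn-not C true  = refl

next≢prev : ∀ w → next w ≢ prev w
next≢prev A ()
next≢prev B ()
next≢prev C ()

turn-injective : ∀ w {a b} → turn w a ≡ turn w b → a ≡ b
turn-injective w {false} {false} _  = refl
turn-injective w {true}  {true}  _  = refl
turn-injective w {false} {true}  eq = ⊥-elim (next≢prev w eq)
turn-injective w {true}  {false} eq = ⊥-elim (next≢prev w (sym eq))

turn-moves : ∀ w η → turn w η ≢ w
turn-moves A false ()
turn-moves A true  ()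
turn-moves B false ()
turn-moves B true  ()
turn-moves C false ()
turn-moves C true  ()

odd : ℕ → Bool
odd zero    = false
odd (suc n) = not (odd n)

bit : Bool → ℕ
bit false = 0
bit true  = 1

bit≤1 : ∀ b → bit b ≤ 1
bit≤1 false = z≤n
bit≤1 true  = ≤-refl

-- G(3, M + 2, 2) with M = m + 1: white vertices A, B, C (C saturated), unsaturated black vertices
-- U₀ (not adjacent to A) and U₁ (not adjacent to B), saturated black vertices D j b with j ≤ M.
-- Writing Dⱼ for D j false and Dⱼ′ for D j true, the cyclic orders around the white vertices are
--   C : U₀ D₀ D₀′ D₁ D₁′ … D_M D_M′, with U₁ inserted right after D_k,
--   A : D₀ D₀′ D₁′ D₁ D₂′ D₂ … D_M′ D_M, with U₁ inserted between the two vertices of index k,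
--   B : U₀ D₀ D_M … D₁ D₀′ D₁ … D_M, where the descending run passes D j b with b = [M − j odd]
--       and the ascending run passes the other vertex of index j,
-- so that U₀ and U₁ are 2k + 1 apart around C.
module Construction (m k : ℕ) (k≤M : k ≤ suc m) where

  M : ℕ
  M = suc m

  descends : ℕ → Bool → Bool
  descends j b = not (odd j xor b xor odd M)

  below : ℕ → Bool → Node
  below zero    b = D 0 true
  below (suc j) b = D (suc j) (not b)

  above above⁻ : ℕ → Bool → Node
  above  j b = if suc j ≡ᵇ M then U₀ else D (suc (suc j)) (not b)
  above⁻ j b = if suc j ≡ᵇ M then D 0 false else D (suc (suc j)) (not b)

  rotA rotA⁻ rotB rotB⁻ rotC rotC⁻ : Node → Node
  rotA U₁                 = if k ≡ᵇ 0 then D 0 true else D k false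
  rotA (D zero false)     = if k ≡ᵇ 0 then U₁ else D 0 true
  rotA (D zero true)      = D 1 true
  rotA (D (suc j) true)   = if suc j ≡ᵇ k then U₁ else D (suc j) false
  rotA (D (suc j) false)  = if suc j ≡ᵇ M then D 0 false else D (suc (suc j)) true
  rotA _                  = U₀

  rotA⁻ U₁                     = if k ≡ᵇ 0 then D 0 false else D k true
  rotA⁻ (D zero false)         = D M false
  rotA⁻ (D (suc j) false)      = if suc j ≡ᵇ k then U₁ else D (suc j) true
  rotA⁻ (D zero true)          = if k ≡ᵇ 0 then U₁ else D 0 false
  rotA⁻ (D (suc zero) true)    = D 0 true
  rotA⁻ (D (suc (suc j)) true) = D (suc j) false
  rotA⁻ _                      = U₀

  rotB U₀             = D 0 false
  rotB (D zero false) = D M false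
  rotB (D zero true)  = D 1 (odd M)
  rotB (D (suc j) b)  = if descends (suc j) b then below j b else above j b
  rotB _              = U₀

  rotB⁻ U₀             = D M true
  rotB⁻ (D zero false) = U₀
  rotB⁻ (D zero true)  = D 1 (not (odd M))
  rotB⁻ (D (suc j) b)  = if descends (suc j) b then above⁻ j b else below j b
  rotB⁻ _              = U₀

  rotC U₀          = D 0 false
  rotC U₁          = D k true
  rotC (D j false) = if j ≡ᵇ k then U₁ else D j true
  rotC (D j true)  = if j ≡ᵇ M then U₀ else D (suc j) false
  rotC _           = U₀

  rotC⁻ U₀                = D M true
  rotC⁻ U₁                = D k false
  rotC⁻ (D j true)        = if j ≡ᵇ k then U₁ else D j false
  rotC⁻ (D zero false)    = U₀
  rotC⁻ (D (suc j) false) = D j true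
  rotC⁻ _                 = U₀

  -- the D clause comes first so that Nbr w (D j b) computes for an unknown w
  Nbr : White → Node → Set
  Nbr _ (D j _) = j ≤ M
  Nbr A U₁      = ⊤
  Nbr B U₀      = ⊤
  Nbr C U₀      = ⊤
  Nbr C U₁      = ⊤
  Nbr _ _       = ⊥

  double-≤ : ∀ {j} → j ≤ M → j + j ≤ M + M
  double-≤ le = +-mono-≤ le le

  rotC-f≢ : ∀ {j} → j ≢ k → rotC (D j false) ≡ D j true
  rotC-f≢ ne = if-false (≢⇒≡ᵇ-false ne)

  rotC-f≡ : ∀ {j} → j ≡ k → rotC (D j false) ≡ U₁
  rotC-f≡ {j} refl = if-true (≡ᵇ-refl j)

  rotC-t≢ : ∀ {j} → j ≢ M → rotC (D j true) ≡ D (suc j) false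
  rotC-t≢ ne = if-false (≢⇒≡ᵇ-false ne)

  rotC-t≡ : ∀ {j} → j ≡ M → rotC (D j true) ≡ U₀
  rotC-t≡ {j} refl = if-true (≡ᵇ-refl j)

  rotC⁻-t≢ : ∀ {j} → j ≢ k → rotC⁻ (D j true) ≡ D j false
  rotC⁻-t≢ ne = if-false (≢⇒≡ᵇ-false ne)

  rotC⁻-t≡ : ∀ {j} → j ≡ k → rotC⁻ (D j true) ≡ U₁
  rotC⁻-t≡ {j} refl = if-true (≡ᵇ-refl j)

  -- the position of x in the cyclic order around C, counted from U₀
  rankC : Node → ℕ
  rankC U₁          = suc (suc (k + k))
  rankC (D j false) = bit (k <ᵇ j) + suc (j + j)
  rankC (D j true)  = bit (k ≤ᵇ j) + suc (suc (j + j))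
  rankC _           = 0

  rotC-nbr : ∀ x → Nbr C x → Nbr C (rotC x)
  rotC-nbr U₀ _ = z≤n
  rotC-nbr U₁ _ = k≤M
  rotC-nbr (D j false) a with j ≟ k
  ... | yes e rewrite rotC-f≡ e = tt
  ... | no ne rewrite rotC-f≢ ne = a
  rotC-nbr (D j true) a with j ≟ M
  ... | yes e rewrite rotC-t≡ e = tt
  ... | no ne rewrite rotC-t≢ ne = ≤∧≢⇒< a ne

  rotC⁻-nbr : ∀ x → Nbr C x → Nbr C (rotC⁻ x)
  rotC⁻-nbr U₀ _ = ≤-refl
  rotC⁻-nbr U₁ _ = k≤M
  rotC⁻-nbr (D j true) a with j ≟ k
  ... | yes e rewrite rotC⁻-t≡ e = tt
  ... | no ne rewrite rotC⁻-t≢ ne = a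
  rotC⁻-nbr (D zero false) _ = tt
  rotC⁻-nbr (D (suc j) false) a = <⇒≤ a

  rotC-rotC⁻ : ∀ x → Nbr C x → rotC (rotC⁻ x) ≡ x
  rotC-rotC⁻ U₀ _ = rotC-t≡ refl
  rotC-rotC⁻ U₁ _ = rotC-f≡ refl
  rotC-rotC⁻ (D j true) a with j ≟ k
  ... | yes refl rewrite rotC⁻-t≡ {j} refl = refl
  ... | no ne rewrite rotC⁻-t≢ ne = rotC-f≢ ne
  rotC-rotC⁻ (D zero false) _ = refl
  rotC-rotC⁻ (D (suc j) false) a = rotC-t≢ (<⇒≢ a)

  rotC⁻-rotC : ∀ x → Nbr C x → rotC⁻ (rotC x) ≡ x
  rotC⁻-rotC U₀ _ = refl
  rotC⁻-rotC U₁ _ = rotC⁻-t≡ refl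
  rotC⁻-rotC (D j false) a with j ≟ k
  ... | yes refl rewrite rotC-f≡ {j} refl = refl
  ... | no ne rewrite rotC-f≢ ne = rotC⁻-t≢ ne
  rotC⁻-rotC (D j true) a with j ≟ M
  ... | yes refl rewrite rotC-t≡ {j} refl = refl
  ... | no ne rewrite rotC-t≢ ne = refl

  rankC-step : ∀ x → Nbr C x → rotC x ≡ U₀ ⊎ rankC (rotC x) ≡ suc (rankC x)
  rankC-step U₀ _ rewrite <ᵇ-false {k} {0} z≤n = inj₂ refl
  rankC-step U₁ _ rewrite ≤ᵇ-true {k} {k} ≤-refl = inj₂ refl
  rankC-step (D j false) a with j ≟ k
  ... | yes refl rewrite rotC-f≡ {j} refl | <ᵇ-false {j} {j} ≤-refl = inj₂ refl
  ... | no ne rewrite rotC-f≢ ne with <-cmp j k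
  ...   | tri< lt _ _ rewrite ≤ᵇ-false {k} {j} lt | <ᵇ-false {k} {j} (<⇒≤ lt) = inj₂ refl
  ...   | tri≈ _ e _ = ⊥-elim (ne e)
  ...   | tri> _ _ gt rewrite ≤ᵇ-true {k} {j} (<⇒≤ gt) | <ᵇ-true {k} {j} gt = inj₂ refl
  rankC-step (D j true) a with j ≟ M
  ... | yes e = inj₁ (rotC-t≡ e)
  ... | no ne rewrite rotC-t≢ ne with k ≤? j
  ...   | yes le rewrite ≤ᵇ-true {k} {j} le | <ᵇ-true {k} {suc j} (s≤s le) | +-suc j j = inj₂ refl
  ...   | no nle rewrite ≤ᵇ-false {k} {j} (≰⇒> nle) | <ᵇ-false {k} {suc j} (≰⇒> nle) | +-suc j j = inj₂ refl

  rankC-bound : ∀ x → Nbr C x → rankC x < suc (suc (suc (suc (M + M))))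
  rankC-bound U₀ _ = s≤s z≤n
  rankC-bound U₁ _ = s≤s (s≤s (s≤s (m≤n⇒m≤1+n (double-≤ k≤M))))
  rankC-bound (D j false) a = s≤s (+-mono-≤ (bit≤1 (k <ᵇ j)) (s≤s (m≤n⇒m≤1+n (double-≤ a))))
  rankC-bound (D j true) a = s≤s (+-mono-≤ (bit≤1 (k ≤ᵇ j)) (s≤s (s≤s (double-≤ a))))

  cycleC : RankedCycle (Nbr C) rotC rotC⁻
  cycleC = record
    { r-closed = rotC-nbr ; r⁻-closed = rotC⁻-nbr ; r-r⁻ = rotC-rotC⁻ ; r⁻-r = rotC⁻-rotC
    ; base = U₀ ; rank = rankC ; rank-step = rankC-step
    ; bound = suc (suc (suc (suc (M + M)))) ; rank-bound = rankC-bound }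

  rotA-0f≡ : k ≡ 0 → rotA (D 0 false) ≡ U₁
  rotA-0f≡ refl = refl

  rotA-0f≢ : k ≢ 0 → rotA (D 0 false) ≡ D 0 true
  rotA-0f≢ ne = if-false (≢⇒≡ᵇ-false ne)

  rotA-t≡ : ∀ {j} → suc j ≡ k → rotA (D (suc j) true) ≡ U₁
  rotA-t≡ {j} refl = if-true (≡ᵇ-refl j)

  rotA-t≢ : ∀ {j} → suc j ≢ k → rotA (D (suc j) true) ≡ D (suc j) false
  rotA-t≢ ne = if-false (≢⇒≡ᵇ-false ne)

  rotA-f≡ : ∀ {j} → suc j ≡ M → rotA (D (suc j) false) ≡ D 0 false
  rotA-f≡ {j} refl = if-true (≡ᵇ-refl j)

  rotA-f≢ : ∀ {j} → suc j ≢ M → rotA (D (suc j) false) ≡ D (suc (suc j)) true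
  rotA-f≢ ne = if-false (≢⇒≡ᵇ-false ne)

  rotA-U≡ : k ≡ 0 → rotA U₁ ≡ D 0 true
  rotA-U≡ refl = refl

  rotA-U≢ : k ≢ 0 → rotA U₁ ≡ D k false
  rotA-U≢ ne = if-false (≢⇒≡ᵇ-false ne)

  rotA⁻-U≡ : k ≡ 0 → rotA⁻ U₁ ≡ D 0 false
  rotA⁻-U≡ refl = refl

  rotA⁻-U≢ : k ≢ 0 → rotA⁻ U₁ ≡ D k true
  rotA⁻-U≢ ne = if-false (≢⇒≡ᵇ-false ne)

  rotA⁻-0t≡ : k ≡ 0 → rotA⁻ (D 0 true) ≡ U₁
  rotA⁻-0t≡ refl = refl

  rotA⁻-0t≢ : k ≢ 0 → rotA⁻ (D 0 true) ≡ D 0 false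
  rotA⁻-0t≢ ne = if-false (≢⇒≡ᵇ-false ne)

  rotA⁻-f≡ : ∀ {j} → suc j ≡ k → rotA⁻ (D (suc j) false) ≡ U₁
  rotA⁻-f≡ {j} refl = if-true (≡ᵇ-refl j)

  rotA⁻-f≢ : ∀ {j} → suc j ≢ k → rotA⁻ (D (suc j) false) ≡ D (suc j) true
  rotA⁻-f≢ ne = if-false (≢⇒≡ᵇ-false ne)

  rotA-kt : ∀ {j} → j ≡ k → j ≢ 0 → rotA (D j true) ≡ U₁
  rotA-kt {zero}  _ ne = ⊥-elim (ne refl)
  rotA-kt {suc j} e _  = rotA-t≡ e

  rotA⁻-kf : ∀ {j} → j ≡ k → j ≢ 0 → rotA⁻ (D j false) ≡ U₁
  rotA⁻-kf {zero}  _ ne = ⊥-elim (ne refl)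
  rotA⁻-kf {suc j} e _  = rotA⁻-f≡ e

  suc≡k⇒k≢0 : ∀ {j} → suc j ≡ k → k ≢ 0
  suc≡k⇒k≢0 refl ()

  -- the position of x in the cyclic order around A, counted from D 0 false
  rankA : Node → ℕ
  rankA (D zero true)      = suc (bit (k ≡ᵇ 0))
  rankA (D (suc j) true)   = bit (k <ᵇ suc j) + (suc j + suc j)
  rankA (D (suc j) false)  = bit (k ≤ᵇ suc j) + suc (suc j + suc j)
  rankA U₁                 = suc (k + k)
  rankA _                  = 0

  rotA-nbr : ∀ x → Nbr A x → Nbr A (rotA x)
  rotA-nbr U₁ _ with k ≟ 0
  ... | yes e rewrite rotA-U≡ e = z≤n
  ... | no ne rewrite rotA-U≢ ne = k≤M
  rotA-nbr (D zero false) _ with k ≟ 0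
  ... | yes e rewrite rotA-0f≡ e = tt
  ... | no ne rewrite rotA-0f≢ ne = z≤n
  rotA-nbr (D zero true) _ = s≤s z≤n
  rotA-nbr (D (suc j) true) a with suc j ≟ k
  ... | yes e rewrite rotA-t≡ e = tt
  ... | no ne rewrite rotA-t≢ ne = a
  rotA-nbr (D (suc j) false) a with suc j ≟ M
  ... | yes e rewrite rotA-f≡ e = z≤n
  ... | no ne rewrite rotA-f≢ ne = ≤∧≢⇒< a ne

  rotA⁻-nbr : ∀ x → Nbr A x → Nbr A (rotA⁻ x)
  rotA⁻-nbr U₁ _ with k ≟ 0
  ... | yes e rewrite rotA⁻-U≡ e = z≤n
  ... | no ne rewrite rotA⁻-U≢ ne = k≤M
  rotA⁻-nbr (D zero false) _ = ≤-refl
  rotA⁻-nbr (D zero true) _ with k ≟ 0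
  ... | yes e rewrite rotA⁻-0t≡ e = tt
  ... | no ne rewrite rotA⁻-0t≢ ne = z≤n
  rotA⁻-nbr (D (suc zero) true) _ = z≤n
  rotA⁻-nbr (D (suc (suc j)) true) a = <⇒≤ a
  rotA⁻-nbr (D (suc j) false) a with suc j ≟ k
  ... | yes e rewrite rotA⁻-f≡ e = tt
  ... | no ne rewrite rotA⁻-f≢ ne = a

  rotA-rotA⁻ : ∀ x → Nbr A x → rotA (rotA⁻ x) ≡ x
  rotA-rotA⁻ U₁ _ with k ≟ 0
  ... | yes e rewrite rotA⁻-U≡ e = rotA-0f≡ e
  ... | no ne rewrite rotA⁻-U≢ ne = rotA-kt refl ne
  rotA-rotA⁻ (D zero false) _ = rotA-f≡ refl
  rotA-rotA⁻ (D zero true) _ with k ≟ 0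
  ... | yes e rewrite rotA⁻-0t≡ e = rotA-U≡ e
  ... | no ne rewrite rotA⁻-0t≢ ne = rotA-0f≢ ne
  rotA-rotA⁻ (D (suc zero) true) _ = refl
  rotA-rotA⁻ (D (suc (suc j)) true) a = rotA-f≢ (<⇒≢ a)
  rotA-rotA⁻ (D (suc j) false) _ with suc j ≟ k
  ... | yes e rewrite rotA⁻-f≡ e | rotA-U≢ (suc≡k⇒k≢0 e) | e = refl
  ... | no ne rewrite rotA⁻-f≢ ne = rotA-t≢ ne

  rotA⁻-rotA : ∀ x → Nbr A x → rotA⁻ (rotA x) ≡ x
  rotA⁻-rotA U₁ _ with k ≟ 0
  ... | yes e rewrite rotA-U≡ e = rotA⁻-0t≡ e
  ... | no ne rewrite rotA-U≢ ne = rotA⁻-kf refl ne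
  rotA⁻-rotA (D zero false) _ with k ≟ 0
  ... | yes e rewrite rotA-0f≡ e = rotA⁻-U≡ e
  ... | no ne rewrite rotA-0f≢ ne = rotA⁻-0t≢ ne
  rotA⁻-rotA (D zero true) _ = refl
  rotA⁻-rotA (D (suc j) true) _ with suc j ≟ k
  ... | yes e rewrite rotA-t≡ e | rotA⁻-U≢ (suc≡k⇒k≢0 e) | e = refl
  ... | no ne rewrite rotA-t≢ ne = rotA⁻-f≢ ne
  rotA⁻-rotA (D (suc j) false) _ with suc j ≟ M
  ... | yes e rewrite rotA-f≡ e | e = refl
  ... | no ne rewrite rotA-f≢ ne = refl

  rankA-kf : ∀ {j} → j ≡ k → j ≢ 0 → rankA (D j false) ≡ suc (suc (k + k))
  rankA-kf {zero}  _    ne = ⊥-elim (ne refl)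
  rankA-kf {suc j} refl _ rewrite ≤ᵇ-true {suc j} {suc j} ≤-refl = refl

  rankA-step : ∀ x → Nbr A x → rotA x ≡ D 0 false ⊎ rankA (rotA x) ≡ suc (rankA x)
  rankA-step U₁ _ with k ≟ 0
  ... | yes e rewrite rotA-U≡ e | e = inj₂ refl
  ... | no ne rewrite rotA-U≢ ne = inj₂ (rankA-kf refl ne)
  rankA-step (D zero false) _ with k ≟ 0
  ... | yes e rewrite rotA-0f≡ e | e = inj₂ refl
  ... | no ne rewrite rotA-0f≢ ne | ≢⇒≡ᵇ-false ne = inj₂ refl
  rankA-step (D zero true) _ with k ≟ 0
  ... | yes e rewrite e = inj₂ refl
  ... | no ne rewrite ≢⇒≡ᵇ-false ne | <ᵇ-false {k} {1} (n≢0⇒n>0 ne) = inj₂ refl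
  rankA-step (D (suc j) true) _ with suc j ≟ k
  ... | yes e rewrite rotA-t≡ e | sym e | <ᵇ-false {suc j} {suc j} ≤-refl = inj₂ refl
  ... | no ne rewrite rotA-t≢ ne with <-cmp (suc j) k
  ...   | tri< lt _ _ rewrite ≤ᵇ-false {k} {suc j} lt | <ᵇ-false {k} {suc j} (<⇒≤ lt) = inj₂ refl
  ...   | tri≈ _ e _ = ⊥-elim (ne e)
  ...   | tri> _ _ gt rewrite ≤ᵇ-true {k} {suc j} (<⇒≤ gt) | <ᵇ-true {k} {suc j} gt = inj₂ refl
  rankA-step (D (suc j) false) _ with suc j ≟ M
  ... | yes e = inj₁ (rotA-f≡ e)
  ... | no ne rewrite rotA-f≢ ne with k ≤? suc j
  ...   | yes le rewrite ≤ᵇ-true {k} {suc j} le | <ᵇ-true {k} {suc (suc j)} (s≤s le) | +-suc j (suc j) = inj₂ refl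
  ...   | no nle rewrite ≤ᵇ-false {k} {suc j} (≰⇒> nle)
                       | <ᵇ-false {k} {suc (suc j)} (≰⇒> nle)
                       | +-suc j (suc j) = inj₂ refl

  rankA-bound : ∀ x → Nbr A x → rankA x < suc (suc (suc (M + M)))
  rankA-bound (D zero false) _ = s≤s z≤n
  rankA-bound (D zero true) _ = s≤s (s≤s (≤-trans (bit≤1 (k ≡ᵇ 0)) (s≤s z≤n)))
  rankA-bound (D (suc j) true) a = s≤s (+-mono-≤ (bit≤1 (k <ᵇ suc j)) (m≤n⇒m≤1+n (double-≤ a)))
  rankA-bound (D (suc j) false) a = s≤s (+-mono-≤ (bit≤1 (k ≤ᵇ suc j)) (s≤s (double-≤ a)))
  rankA-bound U₁ _ = s≤s (s≤s (m≤n⇒m≤1+n (double-≤ k≤M)))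

  cycleA : RankedCycle (Nbr A) rotA rotA⁻
  cycleA = record
    { r-closed = rotA-nbr ; r⁻-closed = rotA⁻-nbr ; r-r⁻ = rotA-rotA⁻ ; r⁻-r = rotA⁻-rotA
    ; base = D 0 false ; rank = rankA ; rank-step = rankA-step
    ; bound = suc (suc (suc (M + M))) ; rank-bound = rankA-bound }

  descends-suc-suc : ∀ j b → descends (suc (suc j)) b ≡ descends (suc j) (not b)
  descends-suc-suc j b with odd j | b | odd M
  ... | false | false | false = refl
  ... | false | false | true  = refl
  ... | false | true  | false = refl
  ... | false | true  | true  = refl
  ... | true  | false | false = refl
  ... | true  | false | true  = refl
  ... | true  | true  | false = refl
  ... | true  | true  | true  = refl

  descends-suc-suc-not : ∀ j b → descends (suc (suc j)) (not b) ≡ descends (suc j) b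
  descends-suc-suc-not j b = trans (descends-suc-suc j (not b)) (cong (descends (suc j)) (not-involutive b))

  descends-M : ∀ b → descends M b ≡ not b
  descends-M b with odd m | b
  ... | false | false = refl
  ... | false | true  = refl
  ... | true  | false = refl
  ... | true  | true  = refl

  descends-1 : ∀ b → descends 1 b ≡ b xor odd M
  descends-1 b with odd M | b
  ... | false | false = refl
  ... | false | true  = refl
  ... | true  | false = refl
  ... | true  | true  = refl

  descends-top : ∀ {j} b → suc j ≡ M → descends (suc j) b ≡ not b
  descends-top b refl = descends-M b

  rotB-desc : ∀ {j b} → descends (suc j) b ≡ true → rotB (D (suc j) b) ≡ below j b
  rotB-desc = if-true

  rotB-asc : ∀ {j b} → descends (suc j) b ≡ false → rotB (D (suc j) b) ≡ above j b
  rotB-asc = if-false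

  rotB⁻-desc : ∀ {j b} → descends (suc j) b ≡ true → rotB⁻ (D (suc j) b) ≡ above⁻ j b
  rotB⁻-desc = if-true

  rotB⁻-asc : ∀ {j b} → descends (suc j) b ≡ false → rotB⁻ (D (suc j) b) ≡ below j b
  rotB⁻-asc = if-false

  above≡ : ∀ {j b} → suc j ≡ M → above j b ≡ U₀
  above≡ {j} refl = if-true (≡ᵇ-refl j)

  above≢ : ∀ {j b} → suc j ≢ M → above j b ≡ D (suc (suc j)) (not b)
  above≢ ne = if-false (≢⇒≡ᵇ-false ne)

  above⁻≡ : ∀ {j b} → suc j ≡ M → above⁻ j b ≡ D 0 false
  above⁻≡ {j} refl = if-true (≡ᵇ-refl j)

  above⁻≢ : ∀ {j b} → suc j ≢ M → above⁻ j b ≡ D (suc (suc j)) (not b)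
  above⁻≢ ne = if-false (≢⇒≡ᵇ-false ne)

  rotB-Mt : rotB (D M true) ≡ U₀
  rotB-Mt rewrite rotB-asc {m} {true} (descends-M true) = above≡ {m} refl

  rotB⁻-Mf : rotB⁻ (D M false) ≡ D 0 false
  rotB⁻-Mf rewrite rotB⁻-desc {m} {false} (descends-M false) = above⁻≡ {m} refl

  below-nbr : ∀ j b → suc j ≤ M → Nbr B (below j b)
  below-nbr zero    b _ = z≤n
  below-nbr (suc j) b a = <⇒≤ a

  xor-true⇒ : ∀ {a} b → a xor b ≡ true → a ≡ not b
  xor-true⇒ {a} b e = trans (sym (xor-cancelʳ a b)) (cong (_xor b) e)

  xor-false⇒ : ∀ {a} b → a xor b ≡ false → a ≡ b
  xor-false⇒ {a} b e = trans (sym (xor-cancelʳ a b)) (cong (_xor b) e)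

  -- the position of x in the cyclic order around B, counted from U₀
  rankB : Node → ℕ
  rankB (D zero false) = 1
  rankB (D zero true)  = suc (suc M)
  rankB (D (suc j) b)  = if descends (suc j) b then suc (suc M) ∸ suc j else suc (suc M) + suc j
  rankB _              = 0

  rotB-nbr : ∀ x → Nbr B x → Nbr B (rotB x)
  rotB-nbr U₀ _ = z≤n
  rotB-nbr (D zero false) _ = ≤-refl
  rotB-nbr (D zero true) _ = s≤s z≤n
  rotB-nbr (D (suc j) b) a with descends (suc j) b in e
  ... | true = below-nbr j b a
  ... | false with suc j ≟ M
  ...   | yes top rewrite above≡ {j} {b} top = tt
  ...   | no ne rewrite above≢ {j} {b} ne = ≤∧≢⇒< a ne

  rotB⁻-nbr : ∀ x → Nbr B x → Nbr B (rotB⁻ x)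
  rotB⁻-nbr U₀ _ = ≤-refl
  rotB⁻-nbr (D zero false) _ = tt
  rotB⁻-nbr (D zero true) _ = s≤s z≤n
  rotB⁻-nbr (D (suc j) b) a with descends (suc j) b in e
  ... | false = below-nbr j b a
  ... | true with suc j ≟ M
  ...   | yes top rewrite above⁻≡ {j} {b} top = z≤n
  ...   | no ne rewrite above⁻≢ {j} {b} ne = ≤∧≢⇒< a ne

  rotB-rotB⁻ : ∀ x → Nbr B x → rotB (rotB⁻ x) ≡ x
  rotB-rotB⁻ U₀ _ = rotB-Mt
  rotB-rotB⁻ (D zero false) _ = refl
  rotB-rotB⁻ (D zero true) _ rewrite rotB-desc {0} {not (odd M)} (trans (descends-1 (not (odd M))) (xor-inverseˡ (odd M))) = refl
  rotB-rotB⁻ (D (suc j) b) a with descends (suc j) b in e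
  ... | true with suc j ≟ M
  ...   | yes top rewrite above⁻≡ {j} {b} top | not-injective (trans (sym (descends-top b top)) e) | top = refl
  ...   | no ne rewrite above⁻≢ {j} {b} ne
                      | rotB-desc {suc j} {not b} (trans (descends-suc-suc-not j b) e)
                      | not-involutive b = refl
  rotB-rotB⁻ (D (suc zero) b) a | false =
    cong (D 1) (sym (xor-false⇒ (odd M) (trans (sym (descends-1 b)) e)))
  rotB-rotB⁻ (D (suc (suc j)) b) a | false
    rewrite rotB-asc {j} {not b} (trans (sym (descends-suc-suc j b)) e)
          | above≢ {j} {not b} (<⇒≢ a)
          | not-involutive b = refl

  rotB⁻-rotB : ∀ x → Nbr B x → rotB⁻ (rotB x) ≡ x
  rotB⁻-rotB U₀ _ = refl
  rotB⁻-rotB (D zero false) _ = rotB⁻-Mf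
  rotB⁻-rotB (D zero true) _ rewrite rotB⁻-asc {0} {odd M} (trans (descends-1 (odd M)) (xor-same (odd M))) = refl
  rotB⁻-rotB (D (suc j) b) a with descends (suc j) b in e
  ... | false with suc j ≟ M
  ...   | yes top rewrite above≡ {j} {b} top | not-injective (trans (sym (descends-top b top)) e) | top = refl
  ...   | no ne rewrite above≢ {j} {b} ne
                      | rotB⁻-asc {suc j} {not b} (trans (descends-suc-suc-not j b) e)
                      | not-involutive b = refl
  rotB⁻-rotB (D (suc zero) b) a | true =
    cong (D 1) (sym (xor-true⇒ (odd M) (trans (sym (descends-1 b)) e)))
  rotB⁻-rotB (D (suc (suc j)) b) a | true
    rewrite rotB⁻-desc {j} {not b} (trans (sym (descends-suc-suc j b)) e)
          | above⁻≢ {j} {not b} (<⇒≢ a)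
          | not-involutive b = refl

  rankB-step : ∀ x → Nbr B x → rotB x ≡ U₀ ⊎ rankB (rotB x) ≡ suc (rankB x)
  rankB-step U₀ _ = inj₂ refl
  rankB-step (D zero false) _ rewrite descends-M false | m+n∸n≡m 2 m = inj₂ refl
  rankB-step (D zero true) _ rewrite trans (descends-1 (odd M)) (xor-same (odd M)) = inj₂ (+-comm (suc (suc M)) 1)
  rankB-step (D (suc j) b) a with descends (suc j) b in e
  rankB-step (D (suc zero) b) a | true = inj₂ refl
  rankB-step (D (suc (suc j)) b) a | true rewrite trans (sym (descends-suc-suc j b)) e =
    inj₂ (+-∸-assoc 1 (<⇒≤ (<⇒≤ a)))
  rankB-step (D (suc j) b) a | false with suc j ≟ M
  ... | yes top = inj₁ (above≡ top)
  ... | no ne rewrite above≢ {j} {b} ne | trans (descends-suc-suc-not j b) e = inj₂ (+-suc (suc (suc M)) (suc j))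

  rankB-bound : ∀ x → Nbr B x → rankB x < suc (suc (suc (M + M)))
  rankB-bound U₀ _ = s≤s z≤n
  rankB-bound (D zero false) _ = s≤s (s≤s z≤n)
  rankB-bound (D zero true) _ = s≤s (s≤s (s≤s (m≤m+n M M)))
  rankB-bound (D (suc j) b) a with descends (suc j) b
  ... | true  = s≤s (≤-trans (m∸n≤m (suc (suc M)) (suc j)) (s≤s (s≤s (m≤m+n M M))))
  ... | false = s≤s (s≤s (s≤s (+-monoʳ-≤ M a)))

  cycleB : RankedCycle (Nbr B) rotB rotB⁻
  cycleB = record
    { r-closed = rotB-nbr ; r⁻-closed = rotB⁻-nbr ; r-r⁻ = rotB-rotB⁻ ; r⁻-r = rotB⁻-rotB
    ; base = U₀ ; rank = rankB ; rank-step = rankB-step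
    ; bound = suc (suc (suc (M + M))) ; rank-bound = rankB-bound }

  rotW rotW⁻ : White → Node → Node
  rotW A = rotA
  rotW B = rotB
  rotW C = rotC
  rotW⁻ A = rotA⁻
  rotW⁻ B = rotB⁻
  rotW⁻ C = rotC⁻

  cycle : ∀ w → RankedCycle (Nbr w) (rotW w) (rotW⁻ w)
  cycle A = cycleA
  cycle B = cycleB
  cycle C = cycleC

  twist : White → Node → Bool
  twist C (D j b)        = not b
  twist A (D zero b)     = b
  twist A (D (suc j) b)  = not b
  twist B (D zero false) = false
  twist B (D zero true)  = not (odd M)
  twist B (D (suc j) b)  = not (odd (suc j) xor odd M)
  twist A U₁             = not (k ≡ᵇ 0)
  twist B U₀             = true
  twist C U₁             = true
  twist _ _              = false

  Edge : Node → Node → Set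
  Edge (wh w) x      = Nbr w x
  Edge x      (wh w) = Nbr w x
  Edge _      _      = ⊥

  sig : Node → Node → Bool
  sig (wh w) x      = twist w x
  sig x      (wh w) = twist w x
  sig _      _      = false

  rot rot⁻ : Node → Node → Node
  rot (wh w) x       = rotW w x
  rot U₀ (wh B)      = wh C
  rot U₀ (wh C)      = wh B
  rot U₁ (wh A)      = wh C
  rot U₁ (wh C)      = wh A
  rot (D _ _) (wh w) = wh (next w)
  rot _ _            = U₀

  rot⁻ (wh w) x       = rotW⁻ w x
  rot⁻ U₀ (wh B)      = wh C
  rot⁻ U₀ (wh C)      = wh B
  rot⁻ U₁ (wh A)      = wh C
  rot⁻ U₁ (wh C)      = wh A
  rot⁻ (D _ _) (wh w) = wh (prev w)
  rot⁻ _ _            = U₀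

  Edge-sym : ∀ u v → Edge u v → Edge v u
  Edge-sym (wh w) U₀      e = e
  Edge-sym (wh w) U₁      e = e
  Edge-sym (wh w) (D j b) e = e
  Edge-sym U₀      (wh w) e = e
  Edge-sym U₁      (wh w) e = e
  Edge-sym (D j b) (wh w) e = e

  next-cyclic : ∀ v w → ∃ λ n → iter next n v ≡ w
  next-cyclic A A = 0 , refl
  next-cyclic A B = 1 , refl
  next-cyclic A C = 2 , refl
  next-cyclic B A = 2 , refl
  next-cyclic B B = 0 , refl
  next-cyclic B C = 1 , refl
  next-cyclic C A = 1 , refl
  next-cyclic C B = 2 , refl
  next-cyclic C C = 0 , refl

  iter-rot-D : ∀ j b n w → iter (rot (D j b)) n (wh w) ≡ wh (iter next n w)
  iter-rot-D j b zero    w = refl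
  iter-rot-D j b (suc n) w = cong (rot (D j b)) (iter-rot-D j b n w)

  private
    open module Around {w} = RankedCycle (cycle w)

  rot-adj : ∀ u v → Edge u v → Edge u (rot u v)
  rot-adj (wh w) v e = r-closed v e
  rot-adj U₀ (wh B) e = tt
  rot-adj U₀ (wh C) e = tt
  rot-adj U₁ (wh A) e = tt
  rot-adj U₁ (wh C) e = tt
  rot-adj (D j b) (wh w) e = e

  rot⁻-adj : ∀ u v → Edge u v → Edge u (rot⁻ u v)
  rot⁻-adj (wh w) v e = r⁻-closed v e
  rot⁻-adj U₀ (wh B) e = tt
  rot⁻-adj U₀ (wh C) e = tt
  rot⁻-adj U₁ (wh A) e = tt
  rot⁻-adj U₁ (wh C) e = tt
  rot⁻-adj (D j b) (wh w) e = e

  rot-rot⁻ : ∀ u v → Edge u v → rot u (rot⁻ u v) ≡ v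
  rot-rot⁻ (wh w) v e = r-r⁻ v e
  rot-rot⁻ U₀ (wh B) e = refl
  rot-rot⁻ U₀ (wh C) e = refl
  rot-rot⁻ U₁ (wh A) e = refl
  rot-rot⁻ U₁ (wh C) e = refl
  rot-rot⁻ (D j b) (wh A) e = refl
  rot-rot⁻ (D j b) (wh B) e = refl
  rot-rot⁻ (D j b) (wh C) e = refl

  rot⁻-rot : ∀ u v → Edge u v → rot⁻ u (rot u v) ≡ v
  rot⁻-rot (wh w) v e = r⁻-r v e
  rot⁻-rot U₀ (wh B) e = refl
  rot⁻-rot U₀ (wh C) e = refl
  rot⁻-rot U₁ (wh A) e = refl
  rot⁻-rot U₁ (wh C) e = refl
  rot⁻-rot (D j b) (wh A) e = refl
  rot⁻-rot (D j b) (wh B) e = refl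
  rot⁻-rot (D j b) (wh C) e = refl

  rot-cyclic : ∀ u v w → Edge u v → Edge u w → ∃ λ n → iter (rot u) n v ≡ w
  rot-cyclic (wh w) v x e e′ = cyclic v x e e′
  rot-cyclic U₀ (wh B) (wh B) _ _ = 0 , refl
  rot-cyclic U₀ (wh B) (wh C) _ _ = 1 , refl
  rot-cyclic U₀ (wh C) (wh B) _ _ = 1 , refl
  rot-cyclic U₀ (wh C) (wh C) _ _ = 0 , refl
  rot-cyclic U₁ (wh A) (wh A) _ _ = 0 , refl
  rot-cyclic U₁ (wh A) (wh C) _ _ = 1 , refl
  rot-cyclic U₁ (wh C) (wh A) _ _ = 1 , refl
  rot-cyclic U₁ (wh C) (wh C) _ _ = 0 , refl
  rot-cyclic (D j b) (wh v) (wh w) _ _ =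
    let (n , eq) = next-cyclic v w in n , trans (iter-rot-D j b n v) (cong wh eq)

  sig-sym : ∀ u v → Edge u v → sig u v ≡ sig v u
  sig-sym (wh w) U₀      _ = refl
  sig-sym (wh w) U₁      _ = refl
  sig-sym (wh w) (D j b) _ = refl
  sig-sym U₀      (wh w) _ = refl
  sig-sym U₁      (wh w) _ = refl
  sig-sym (D j b) (wh w) _ = refl

  R : RotSys Node Edge
  R = record
    { rot = rot ; rot⁻ = rot⁻ ; sig = sig
    ; rot-adj = rot-adj ; rot⁻-adj = rot⁻-adj ; rot-rot⁻ = rot-rot⁻ ; rot⁻-rot = rot⁻-rot
    ; rot-cyclic = rot-cyclic ; sig-sym = sig-sym }

  open RotSys R using (faceStep; Quadrangular)
  open FaceTracing R Edge-sym using (State; QuadrangularAt; quadrangularAt; quadrangular-from; returns-from-later)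

  twist-B-M : ∀ b → twist B (D M b) ≡ true
  twist-B-M b = cong not (xor-same (odd M))

  -- the other white vertex on the face through the corner {x, rotW t x} at t
  across : White → Node → White
  across t x = turn t (not (twist t x))

  -- the corner {x, y} at w lies on a face whose other white vertex is t
  CornerAt : White → White → Node → Node → Set
  CornerAt t w x y = (rotW w x ≡ y × across w x ≡ t) ⊎ (rotW w y ≡ x × across w y ≡ t)

  descends-twist : ∀ j b → descends (suc j) b ≡ twist B (D (suc j) b) xor b
  descends-twist j b with odd j | b | odd M
  ... | false | false | false = refl
  ... | false | false | true  = refl
  ... | false | true  | false = refl
  ... | false | true  | true  = refl
  ... | true  | false | false = refl
  ... | true  | false | true  = refl
  ... | true  | true  | false = refl
  ... | true  | true  | true  = refl

  twist-B-from-descends : ∀ j b {d} → descends (suc j) b ≡ d → twist B (D (suc j) b) ≡ d xor b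
  twist-B-from-descends j b {d} e =
    trans (sym (xor-cancelʳ _ b)) (cong (_xor b) (trans (sym (descends-twist j b)) e))

  twist-B-suc-suc : ∀ j b b′ → twist B (D (suc (suc j)) b′) ≡ not (twist B (D (suc j) b))
  twist-B-suc-suc j b b′ with odd j | odd M
  ... | false | false = refl
  ... | false | true  = refl
  ... | true  | false = refl
  ... | true  | true  = refl

  twist-B-1 : ∀ b → twist B (D 1 b) ≡ odd M
  twist-B-1 b with odd M
  ... | false = refl
  ... | true  = refl

  twist-alternates-C : ∀ x → Nbr C x → IsD x → IsD (rotC x) → twist C (rotC x) ≡ not (twist C x)
  twist-alternates-C (D j false) _ _ d with j ≟ k
  ... | yes e = ⊥-elim (subst IsD (rotC-f≡ e) d)
  ... | no ne rewrite rotC-f≢ ne = refl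
  twist-alternates-C (D j true) _ _ d with j ≟ M
  ... | yes e = ⊥-elim (subst IsD (rotC-t≡ e) d)
  ... | no ne rewrite rotC-t≢ ne = refl

  corner-shared-C : ∀ x → Nbr C x → IsD x → IsD (rotC x) → CornerAt C (across C x) x (rotC x)
  corner-shared-C (D j false) _ _ d with j ≟ k
  ... | yes e = ⊥-elim (subst IsD (rotC-f≡ e) d)
  ... | no ne rewrite rotC-f≢ ne = at-A j ne
    where
    at-A : ∀ j → j ≢ k → CornerAt C A (D j false) (D j true)
    at-A zero    ne = inj₁ (rotA-0f≢ (λ e → ne (sym e)) , refl)
    at-A (suc j) ne = inj₂ (rotA-t≢ ne , refl)
  corner-shared-C (D j true) _ _ d with j ≟ M
  ... | yes e = ⊥-elim (subst IsD (rotC-t≡ e) d)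
  ... | no ne rewrite rotC-t≢ ne = at-B j ne
    where
    at-B : ∀ j → j ≢ M → CornerAt C B (D j true) (D (suc j) false)
    at-B zero ne with odd M in odd-M
    ... | false = inj₁ (refl , refl)
    ... | true  = inj₂ (refl , refl)
    at-B (suc j) ne with descends (suc j) true in e
    ... | false rewrite above≢ {j} {true} ne | twist-B-from-descends j true e = inj₁ (refl , refl)
    ... | true rewrite rotB-desc {suc j} {false} (trans (descends-suc-suc j false) e)
                     | twist-B-suc-suc j true false | twist-B-from-descends j true e = inj₂ (refl , refl)

  twist-alternates-A : ∀ x → Nbr A x → IsD x → IsD (rotA x) → twist A (rotA x) ≡ not (twist A x)
  twist-alternates-A (D zero false) _ _ d with k ≟ 0
  ... | yes e = ⊥-elim (subst IsD (rotA-0f≡ e) d)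
  ... | no ne rewrite rotA-0f≢ ne = refl
  twist-alternates-A (D zero true) _ _ _ = refl
  twist-alternates-A (D (suc j) true) _ _ d with suc j ≟ k
  ... | yes e = ⊥-elim (subst IsD (rotA-t≡ e) d)
  ... | no ne rewrite rotA-t≢ ne = refl
  twist-alternates-A (D (suc j) false) _ _ _ with suc j ≟ M
  ... | yes e rewrite rotA-f≡ e = refl
  ... | no ne rewrite rotA-f≢ ne = refl

  corner-shared-A : ∀ x → Nbr A x → IsD x → IsD (rotA x) → CornerAt A (across A x) x (rotA x)
  corner-shared-A (D zero false) _ _ d with k ≟ 0
  ... | yes e = ⊥-elim (subst IsD (rotA-0f≡ e) d)
  ... | no ne rewrite rotA-0f≢ ne = inj₁ (rotC-f≢ (λ e → ne (sym e)) , refl)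
  corner-shared-A (D zero true) _ _ _ with odd M in odd-M
  ... | true  = inj₁ (refl , refl)
  ... | false = inj₂ (refl , refl)
  corner-shared-A (D (suc j) true) _ _ d with suc j ≟ k
  ... | yes e = ⊥-elim (subst IsD (rotA-t≡ e) d)
  ... | no ne rewrite rotA-t≢ ne = inj₂ (rotC-f≢ ne , refl)
  corner-shared-A (D (suc j) false) _ _ _ with suc j ≟ M
  ... | yes e rewrite rotA-f≡ e | e = inj₂ (refl , refl)
  ... | no ne rewrite rotA-f≢ ne with descends (suc j) false in e
  ...   | false rewrite above≢ {j} {false} ne = inj₁ (refl , refl)
  ...   | true rewrite rotB-desc {suc j} {true} (trans (descends-suc-suc j true) e)
                     | twist-B-suc-suc j false true | twist-B-from-descends j false e = inj₂ (refl , refl)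

  twist-alternates-B : ∀ x → Nbr B x → IsD x → IsD (rotB x) → twist B (rotB x) ≡ not (twist B x)
  twist-alternates-B (D zero false) _ _ _ = twist-B-M false
  twist-alternates-B (D zero true) _ _ _ rewrite twist-B-1 (odd M) = refl
  twist-alternates-B (D (suc j) b) _ _ d with descends (suc j) b in e
  twist-alternates-B (D (suc zero) b) _ _ _ | true rewrite twist-B-1 b = refl
  twist-alternates-B (D (suc (suc j)) b) _ _ _ | true rewrite twist-B-suc-suc j (not b) b = sym (not-involutive _)
  twist-alternates-B (D (suc j) b) _ _ d | false with suc j ≟ M
  ... | yes top = ⊥-elim (subst IsD (above≡ {j} {b} top) d)
  ... | no ne rewrite above≢ {j} {b} ne = twist-B-suc-suc j b (not b)

  corner-shared-B : ∀ x → Nbr B x → IsD x → IsD (rotB x) → CornerAt B (across B x) x (rotB x)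
  corner-shared-B (D zero false) _ _ _ = inj₂ (rotA-f≡ refl , refl)
  corner-shared-B (D zero true) _ _ _ with odd M in odd-M
  ... | false = inj₁ (rotC-t≢ (λ ()) , refl)
  ... | true  = inj₁ (refl , refl)
  corner-shared-B (D (suc j) b) a _ d with descends (suc j) b in e
  corner-shared-B (D (suc zero) false) _ _ _ | true rewrite twist-B-from-descends 0 false e = inj₂ (rotC-t≢ (λ ()) , refl)
  corner-shared-B (D (suc zero) true) _ _ _ | true rewrite twist-B-from-descends 0 true e = inj₂ (refl , refl)
  corner-shared-B (D (suc (suc j)) false) a _ _ | true rewrite twist-B-from-descends (suc j) false e =
    inj₂ (rotC-t≢ (<⇒≢ a) , refl)
  corner-shared-B (D (suc (suc j)) true) a _ _ | true rewrite twist-B-from-descends (suc j) true e =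
    inj₂ (rotA-f≢ (<⇒≢ a) , refl)
  corner-shared-B (D (suc j) b) _ _ d | false with suc j ≟ M
  ... | yes top = ⊥-elim (subst IsD (above≡ {j} {b} top) d)
  ... | no ne rewrite above≢ {j} {b} ne | twist-B-from-descends j b e with b
  ...   | true  = inj₁ (rotC-t≢ ne , refl)
  ...   | false = inj₁ (rotA-f≢ ne , refl)

  twist-alternates : ∀ t x → Nbr t x → IsD x → IsD (rotW t x) → twist t (rotW t x) ≡ not (twist t x)
  twist-alternates A = twist-alternates-A
  twist-alternates B = twist-alternates-B
  twist-alternates C = twist-alternates-C

  corner-shared : ∀ t x → Nbr t x → IsD x → IsD (rotW t x) → CornerAt t (across t x) x (rotW t x)
  corner-shared A = corner-shared-A
  corner-shared B = corner-shared-B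
  corner-shared C = corner-shared-C

  ρ : White → Bool → Node → Node
  ρ t e x = if e then rotW⁻ t x else rotW t x

  ρ-nbr : ∀ t e x → Nbr t x → Nbr t (ρ t e x)
  ρ-nbr t false = RankedCycle.r-closed (cycle t)
  ρ-nbr t true  = RankedCycle.r⁻-closed (cycle t)

  twist-alternates-ρ : ∀ t e x → Nbr t x → IsD x → IsD (ρ t e x) → twist t (ρ t e x) ≡ not (twist t x)
  twist-alternates-ρ t false x nx dx dy = twist-alternates t x nx dx dy
  twist-alternates-ρ t true  x nx dx dy =
    trans (sym (not-involutive _)) (cong not (sym (trans (cong (twist t) (sym back)) flip)))
    where
    back = RankedCycle.r-r⁻ (cycle t) x nx
    flip = twist-alternates t (rotW⁻ t x) (RankedCycle.r⁻-closed (cycle t) x nx) dy (subst IsD (sym back) dx)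

  -- the other white vertex on the face through the corner {x, ρ t e x} at t
  partner : White → Bool → Node → White
  partner t false x = across t x
  partner t true  x = across t (rotW⁻ t x)

  corner-shared-ρ : ∀ t e x → Nbr t x → IsD x → IsD (ρ t e x) → CornerAt t (partner t e x) x (ρ t e x)
  corner-shared-ρ t false x nx dx dy = corner-shared t x nx dx dy
  corner-shared-ρ t true  x nx dx dy =
    swap (subst (CornerAt t (across t y) y) back
      (corner-shared t y (RankedCycle.r⁻-closed (cycle t) x nx) dy (subst IsD (sym back) dx)))
    where
    y = rotW⁻ t x
    back = RankedCycle.r-r⁻ (cycle t) x nx

  partner-turns-back : ∀ t η x → Nbr t x → IsD x → IsD (ρ t (η xor twist t x) x) →
    partner t (η xor twist t x) x ≡ turn t (not η)
  partner-turns-back t η x nx dx dy with twist t x in tx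
  partner-turns-back t false x nx dx dy | false rewrite tx = refl
  partner-turns-back t true  x nx dx dy | true  rewrite tx = refl
  partner-turns-back t false x nx dx dy | true
    rewrite twist-alternates-ρ t true x nx dx dy | tx = refl
  partner-turns-back t true  x nx dx dy | false
    rewrite twist-alternates-ρ t true x nx dx dy | tx = refl

  land : White → Bool → Node → State
  land τ η x = (wh τ , ρ τ (η xor twist τ x) x , η xor twist τ x)

  hop : White → Node → Bool → State
  hop w x ε = land (turn w (ε xor twist w x)) (ε xor twist w x) x

  faceStep²-hop : ∀ w j b ε → iter faceStep 2 (wh w , D j b , ε) ≡ hop w (D j b) ε
  faceStep²-hop w j b ε with ε xor twist w (D j b)
  ... | false = refl
  ... | true  = refl

  land-at-corner : ∀ {w t x y ε η} → Nbr w x → Nbr w y → IsD x → IsD y →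
    η ≡ ε xor twist w x → t ≡ turn w η → CornerAt t w x y → land w (not η) y ≡ (wh w , x , ε)
  land-at-corner {w} {t} {x} {y} {ε} {η} nx ny dx dy η≡ t≡ (inj₁ (x↦y , across≡)) =
    cong₂ (λ z c → (wh w , z , c)) (trans (cong (λ c → ρ w c y) ζ≡true)
                                          (trans (cong (rotW⁻ w) (sym x↦y)) (RankedCycle.r⁻-r (cycle w) x nx)))
                                   (trans ζ≡true (sym ε≡true))
    where
    tx : twist w x ≡ not η
    tx = trans (sym (not-involutive _)) (cong not (turn-injective w (trans across≡ t≡)))
    ty : twist w y ≡ η
    ty = trans (cong (twist w) (sym x↦y))
               (trans (twist-alternates w x nx dx (subst IsD (sym x↦y) dy)) (trans (cong not tx) (not-involutive η)))
    ζ≡true : not η xor twist w y ≡ true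
    ζ≡true = trans (cong (not η xor_) ty) (xor-inverseˡ η)
    ε≡true : ε ≡ true
    ε≡true = trans (sym (xor-cancelʳ ε (twist w x))) (trans (cong₂ _xor_ (sym η≡) tx) (xor-inverseʳ η))
  land-at-corner {w} {t} {x} {y} {ε} {η} nx ny dx dy η≡ t≡ (inj₂ (y↦x , across≡)) =
    cong₂ (λ z c → (wh w , z , c)) (trans (cong (λ c → ρ w c y) ζ≡false) y↦x) (trans ζ≡false (sym ε≡false))
    where
    ty : twist w y ≡ not η
    ty = trans (sym (not-involutive _)) (cong not (turn-injective w (trans across≡ t≡)))
    tx : twist w x ≡ η
    tx = trans (cong (twist w) (sym y↦x))
               (trans (twist-alternates w y ny dy (subst IsD (sym y↦x) dx)) (trans (cong not ty) (not-involutive η)))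
    ζ≡false : not η xor twist w y ≡ false
    ζ≡false = trans (cong (not η xor_) ty) (xor-same (not η))
    ε≡false : ε ≡ false
    ε≡false = trans (sym (xor-cancelʳ ε (twist w x))) (trans (cong₂ _xor_ (sym η≡) tx) (xor-same η))

  -- two hops through the corner {x, y} that t shares with w bring the face back to its start
  hop-hop : ∀ {w t x y ε e} → Nbr w x → Nbr w y → IsD x → IsD y →
    t ≡ turn w (ε xor twist w x) → e ≡ (ε xor twist w x) xor twist t x →
    twist t y ≡ not (twist t x) → CornerAt t w x y → hop t y e ≡ (wh w , x , ε)
  hop-hop {w} {t} {x} {y} {ε} {e} nx ny dx dy t≡ e≡ alternates corner = begin
    land (turn t (e xor twist t y)) (e xor twist t y) y
      ≡⟨ cong₂ (λ τ η → land τ η y) back-at-w η′≡ ⟩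
    land w (not η) y
      ≡⟨ land-at-corner nx ny dx dy refl t≡ corner ⟩
    (wh w , x , ε) ∎
    where
    open ≡-Reasoning
    η = ε xor twist w x
    η′≡ : e xor twist t y ≡ not η
    η′≡ = trans (cong₂ _xor_ e≡ alternates) (xor-xor-not η (twist t x))
    back-at-w : turn t (e xor twist t y) ≡ w
    back-at-w = trans (cong (turn t) η′≡) (trans (cong (λ τ → turn τ (not η)) t≡) (turn-turn-not w η))

  returns-U₀ : ∀ w ε → Nbr w U₀ → iter faceStep 4 (wh w , U₀ , ε) ≡ (wh w , U₀ , ε)
  returns-U₀ B false _ rewrite twist-B-M true | rotB-Mt = refl
  returns-U₀ B true  _ = refl
  returns-U₀ C false _ rewrite twist-B-M true | rotC-t≡ {M} refl = refl
  returns-U₀ C true  _ = refl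

  returns-U₁ : ∀ w ε → Nbr w U₁ → iter faceStep 4 (wh w , U₁ , ε) ≡ (wh w , U₁ , ε)
  returns-U₁ A ε _ with k ≟ 0
  returns-U₁ A false _ | yes refl = refl
  returns-U₁ A true  _ | yes refl = refl
  returns-U₁ A ε _ | no ne with ≢0⇒suc ne
  returns-U₁ A false _ | no ne | k′ , refl rewrite ≡ᵇ-refl k′ = refl
  returns-U₁ A true  _ | no ne | k′ , refl rewrite ≡ᵇ-refl k′ = refl
  returns-U₁ C ε _ with k ≟ 0
  returns-U₁ C false _ | yes refl = refl
  returns-U₁ C true  _ | yes refl = refl
  returns-U₁ C ε _ | no ne with ≢0⇒suc ne
  returns-U₁ C false _ | no ne | k′ , refl rewrite ≡ᵇ-refl k′ = refl
  returns-U₁ C true  _ | no ne | k′ , refl rewrite ≡ᵇ-refl k′ = refl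

  returns-white-D : ∀ w j b ε → Nbr w (D j b) → iter faceStep 4 (wh w , D j b , ε) ≡ (wh w , D j b , ε)
  returns-white-D w j b ε nx = trans (cong (iter faceStep 2) (faceStep²-hop w j b ε)) second-hop
    where
    x = D j b
    η = ε xor twist w x
    t = turn w η
    e = η xor twist t x

    via-U : ∀ u → ρ t e x ≡ u → iter faceStep 4 (wh t , u , e) ≡ (wh t , u , e) →
      iter faceStep 2 (wh t , u , e) ≡ (wh w , x , ε)
    via-U u y≡ back = trans (cong (iter faceStep 2) (sym two≡))
      (returns-from-later 2 (wh w , x , ε) nx (trans (cong (iter faceStep 4) two≡) (trans back (sym two≡))))
      where
      two≡ : iter faceStep 2 (wh w , x , ε) ≡ (wh t , u , e)
      two≡ = trans (faceStep²-hop w j b ε) (cong (λ y → (wh t , y , e)) y≡)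

    second-hop : iter faceStep 2 (wh t , ρ t e x , e) ≡ (wh w , x , ε)
    second-hop with ρ t e x in y≡ | ρ-nbr t e x nx
    ... | D j′ b′ | ny = trans (faceStep²-hop t j′ b′ e) (hop-hop nx ny tt tt refl refl alternates corner)
      where
      dy : IsD (ρ t e x)
      dy = subst IsD (sym y≡) tt
      alternates : twist t (D j′ b′) ≡ not (twist t x)
      alternates = subst (λ y → twist t y ≡ not (twist t x)) y≡ (twist-alternates-ρ t e x nx tt dy)
      partner≡ : partner t e x ≡ w
      partner≡ = trans (partner-turns-back t η x nx tt dy) (turn-turn-not w η)
      corner : CornerAt t w x (D j′ b′)
      corner = subst₂ (λ w′ y → CornerAt t w′ x y) partner≡ y≡ (corner-shared-ρ t e x nx tt dy)
    ... | U₀ | ny = via-U U₀ y≡ (returns-U₀ t e ny)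
    ... | U₁ | ny = via-U U₁ y≡ (returns-U₁ t e ny)

  returns-white : ∀ w x ε → Nbr w x → iter faceStep 4 (wh w , x , ε) ≡ (wh w , x , ε)
  returns-white w (D j b) ε nx = returns-white-D w j b ε nx
  returns-white w U₀      ε nx = returns-U₀ w ε nx
  returns-white w U₁      ε nx = returns-U₁ w ε nx

  wh-injective : ∀ {v w} → wh v ≡ wh w → v ≡ w
  wh-injective refl = refl

  one-step-moves : ∀ w x ε → Nbr w x → faceStep (wh w , x , ε) ≢ (wh w , x , ε)
  one-step-moves w (D j b) ε _ ()
  one-step-moves w U₀      ε _ ()
  one-step-moves w U₁      ε _ ()

  two-steps-move : ∀ w x ε → Nbr w x → iter faceStep 2 (wh w , x , ε) ≢ (wh w , x , ε)
  two-steps-move w (D j b) ε _ loop =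
    turn-moves w (ε xor twist w (D j b)) (wh-injective (cong proj₁ (trans (sym (faceStep²-hop w j b ε)) loop)))
  two-steps-move B U₀ false _ ()
  two-steps-move B U₀ true  _ ()
  two-steps-move C U₀ false _ ()
  two-steps-move C U₀ true  _ ()
  two-steps-move C U₁ false _ ()
  two-steps-move C U₁ true  _ ()
  two-steps-move A U₁ ε _ with ε xor twist A U₁
  ... | false = λ ()
  ... | true  = λ ()

  edge-at-white : ∀ u v → Edge u v → IsWhite u ⊎ IsWhite v
  edge-at-white (wh _) _      _ = inj₁ tt
  edge-at-white U₀      (wh _) _ = inj₂ tt
  edge-at-white U₁      (wh _) _ = inj₂ tt
  edge-at-white (D _ _) (wh _) _ = inj₂ tt

  quadrangular : Quadrangular
  quadrangular = quadrangular-from IsWhite edge-at-white at-white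
    where
    at-white : ∀ u v ε → IsWhite u → Edge u v → QuadrangularAt (u , v , ε)
    at-white (wh w) x ε _ nx =
      quadrangularAt (returns-white w x ε nx) (one-step-moves w x ε nx) (two-steps-move w x ε nx)

  iter-rotC-U₀ : ∀ j → j ≤ k → iter rotC (suc (j + j)) U₀ ≡ D j false
  iter-rotC-U₀ zero    _ = refl
  iter-rotC-U₀ (suc j) le rewrite +-suc j j | iter-rotC-U₀ j (<⇒≤ le) | rotC-f≢ {j} (<⇒≢ le) =
    rotC-t≢ (<⇒≢ (≤-trans le k≤M))

  U₀-U₁-separated : iter rotC (suc (suc (k + k))) U₀ ≡ U₁
  U₀-U₁-separated = trans (cong rotC (iter-rotC-U₀ k ≤-refl)) (rotC-f≡ refl)

Adj-sym : ∀ n u v → Adj n u v → Adj n v u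
Adj-sym n (inj₁ i) (inj₂ j) e = e
Adj-sym n (inj₂ j) (inj₁ i) e = e

clamp : ∀ {N} → ℕ → Fin (suc N)
clamp         zero    = zero
clamp {zero}  (suc i) = zero
clamp {suc N} (suc i) = suc (clamp i)

toℕ-clamp : ∀ {N} i → i < suc N → toℕ (clamp {N} i) ≡ i
toℕ-clamp         zero    _       = refl
toℕ-clamp {suc N} (suc i) (s≤s l) = cong suc (toℕ-clamp i l)

clamp-toℕ : ∀ {N} (x : Fin (suc N)) → clamp (toℕ x) ≡ x
clamp-toℕ         zero    = refl
clamp-toℕ {suc N} (suc x) = cong suc (clamp-toℕ x)

⌊/2⌋-bound : ∀ M i → i ≤ suc (M + M) → ⌊ i /2⌋ ≤ M
⌊/2⌋-bound M       zero          _ = z≤n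
⌊/2⌋-bound M       (suc zero)    _ = z≤n
⌊/2⌋-bound zero    (suc (suc i)) (s≤s ())
⌊/2⌋-bound (suc M) (suc (suc i)) (s≤s le) rewrite +-suc M M = s≤s (⌊/2⌋-bound M i (≤-pred le))

double+bit : ∀ i → ⌊ i /2⌋ + ⌊ i /2⌋ + bit (odd i) ≡ i
double+bit zero          = refl
double+bit (suc zero)    = refl
double+bit (suc (suc i)) rewrite not-involutive (odd i) | +-suc ⌊ i /2⌋ ⌊ i /2⌋ =
  cong (λ z → suc (suc z)) (double+bit i)

half-double+bit : ∀ j b → ⌊ j + j + bit b /2⌋ ≡ j × odd (j + j + bit b) ≡ b
half-double+bit zero    false = refl , refl
half-double+bit zero    true  = refl , refl
half-double+bit (suc j) b rewrite +-suc j j with half-double+bit j b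
... | half≡ , odd≡ = cong suc half≡ , trans (not-involutive _) odd≡

-- black vertex i of G(3, 2n, 2) is U₀, U₁ or D j b with i = 2 + 2j + b
node : ℕ → Node
node zero          = U₀
node (suc zero)    = U₁
node (suc (suc i)) = D ⌊ i /2⌋ (odd i)

label : Node → ℕ
label U₁      = 1
label (D j b) = suc (suc (j + j + bit b))
label _       = 0

label-node : ∀ i → label (node i) ≡ i
label-node zero          = refl
label-node (suc zero)    = refl
label-node (suc (suc i)) = cong (λ z → suc (suc z)) (double+bit i)

node-label-D : ∀ j b → node (label (D j b)) ≡ D j b
node-label-D j b = cong₂ D (proj₁ (half-double+bit j b)) (proj₂ (half-double+bit j b))

module Embedding (m k : ℕ) (k≤M : k ≤ suc m) where
  open Construction m k k≤M

  n : ℕ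
  n = suc (suc M)

  2n≡ : 2 * n ≡ suc (suc (suc (suc (M + M))))
  2n≡ = cong (λ z → suc (suc z))
    (trans (cong (M +_) (+-identityʳ (suc (suc M)))) (trans (+-suc M (suc M)) (cong suc (+-suc M M))))

  f : Vtx n → Node
  f (inj₁ zero)             = wh A
  f (inj₁ (suc zero))       = wh B
  f (inj₁ (suc (suc zero))) = wh C
  f (inj₂ x)                = node (toℕ x)

  g : Node → Vtx n
  g (wh A) = inj₁ zero
  g (wh B) = inj₁ (suc zero)
  g (wh C) = inj₁ (suc (suc zero))
  g x      = inj₂ (clamp (label x))

  g∘f : ∀ v → g (f v) ≡ v
  g∘f (inj₁ zero)             = refl
  g∘f (inj₁ (suc zero))       = refl
  g∘f (inj₁ (suc (suc zero))) = refl
  g∘f (inj₂ x) = trans (g-node (toℕ x)) (cong inj₂ (trans (cong clamp (label-node (toℕ x))) (clamp-toℕ x)))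
    where
    g-node : ∀ i → g (node i) ≡ inj₂ (clamp (label (node i)))
    g-node zero          = refl
    g-node (suc zero)    = refl
    g-node (suc (suc i)) = refl

  label<2n : ∀ j b → j ≤ M → label (D j b) < 2 * n
  label<2n j b le rewrite 2n≡ =
    s≤s (s≤s (s≤s (subst (j + j + bit b ≤_) (+-comm (M + M) 1) (+-mono-≤ (+-mono-≤ le le) (bit≤1 b)))))

  f∘g : ∀ x y → Edge x y → f (g y) ≡ y
  f∘g x       (wh A)  _ = refl
  f∘g x       (wh B)  _ = refl
  f∘g x       (wh C)  _ = refl
  f∘g x       U₀      _ = refl
  f∘g x       U₁      _ = refl
  f∘g (wh w)  (D j b) e = trans (cong node (toℕ-clamp (label (D j b)) (label<2n j b e))) (node-label-D j b)

  node-bound : ∀ i → suc (suc i) < 2 * n → ⌊ i /2⌋ ≤ M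
  node-bound i lt = ⌊/2⌋-bound M i (≤-pred (≤-pred (≤-pred (subst (suc (suc (suc i)) ≤_) 2n≡ lt))))

  white-black : ∀ i x → Adj n (inj₁ i) (inj₂ x) → Edge (f (inj₁ i)) (f (inj₂ x))
  white-black i x e with toℕ x | toℕ<n x
  white-black zero             x e | zero          | _  = e (refl , s≤s z≤n)
  white-black zero             x e | suc zero      | _  = tt
  white-black zero             x e | suc (suc i)   | lt = node-bound i lt
  white-black (suc zero)       x e | zero          | _  = tt
  white-black (suc zero)       x e | suc zero      | _  = e (refl , s≤s (s≤s z≤n))
  white-black (suc zero)       x e | suc (suc i)   | lt = node-bound i lt
  white-black (suc (suc zero)) x e | zero          | _  = tt
  white-black (suc (suc zero)) x e | suc zero      | _  = tt
  white-black (suc (suc zero)) x e | suc (suc i)   | lt = node-bound i lt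

  Adj⇒Edge : ∀ u v → Adj n u v → Edge (f u) (f v)
  Adj⇒Edge (inj₁ i) (inj₂ x) e = white-black i x e
  Adj⇒Edge (inj₂ x) (inj₁ i) e = Edge-sym (f (inj₁ i)) (f (inj₂ x)) (white-black i x e)

  black-white : ∀ i x → Edge (f (inj₁ i)) (f (inj₂ x)) → Adj n (inj₁ i) (inj₂ x)
  black-white zero             x e (same , _) = subst (λ t → Nbr A (node t)) (sym same) e
  black-white (suc zero)       x e (same , _) = subst (λ t → Nbr B (node t)) (sym same) e
  black-white (suc (suc zero)) x e (_ , s≤s (s≤s ()))

  f-white : ∀ i → IsWhite (f (inj₁ i))
  f-white zero             = tt
  f-white (suc zero)       = tt
  f-white (suc (suc zero)) = tt

  no-white-edge : ∀ {u v} → IsWhite u → IsWhite v → ¬ Edge u v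
  no-white-edge {wh _} {wh _} _ _ ()

  no-black-edge : ∀ i j → ¬ Edge (node i) (node j)
  no-black-edge zero          zero          ()
  no-black-edge zero          (suc zero)    ()
  no-black-edge zero          (suc (suc _)) ()
  no-black-edge (suc zero)    zero          ()
  no-black-edge (suc zero)    (suc zero)    ()
  no-black-edge (suc zero)    (suc (suc _)) ()
  no-black-edge (suc (suc _)) zero          ()
  no-black-edge (suc (suc _)) (suc zero)    ()
  no-black-edge (suc (suc _)) (suc (suc _)) ()

  Edge⇒Adj : ∀ u v → Edge (f u) (f v) → Adj n u v
  Edge⇒Adj (inj₁ i) (inj₂ x) e = black-white i x e
  Edge⇒Adj (inj₂ x) (inj₁ i) e = black-white i x (Edge-sym (f (inj₂ x)) (f (inj₁ i)) e)
  Edge⇒Adj (inj₂ x) (inj₂ y) e = ⊥-elim (no-black-edge (toℕ x) (toℕ y) e)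
  Edge⇒Adj (inj₁ i) (inj₁ j) e = ⊥-elim (no-white-edge (f-white i) (f-white j) e)

  module Pulled = Pullback (Adj n) Edge f g g∘f f∘g Adj⇒Edge Edge⇒Adj (Adj-sym n) R

  embedding : (h : 2 ≤ n) → Σ (RotSys (Vtx n) (Adj n)) λ R →
    RotSys.Quadrangular R × SeparatedBy R (white n (# 2)) (unsatBlack₀ n h) (unsatBlack₁ n h) (suc (k + k))
  embedding h = Pulled.R , Pulled.quadrangular quadrangular ,
    Pulled.separatedBy (white n (# 2)) (unsatBlack₀ n h) (unsatBlack₁ n h) (suc (k + k))
      (λ { (_ , s≤s (s≤s ())) }) (λ { (_ , s≤s (s≤s ())) }) (inj₁ U₀-U₁-separated)

-- n = 2, where the orders of Construction degenerate: the cyclic orders are listed and every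
-- axiom is decided by evaluation
module Smallest where

  module Decide {n : ℕ} where

    V : Set
    V = Vtx n

    _≟ᵛ_ : (u v : V) → Dec (u ≡ v)
    _≟ᵛ_ = Sum.≡-dec _≟ᶠ_ _≟ᶠ_

    ∀-vertex? : {P : V → Set} → (∀ v → Dec (P v)) → Dec (∀ v → P v)
    ∀-vertex? P? = map′ (λ { (p , q) (inj₁ i) → p i ; (p , q) (inj₂ j) → q j })
                        (λ all → all ∘ inj₁ , all ∘ inj₂)
                        (all? (P? ∘ inj₁) ×-dec all? (P? ∘ inj₂))

    ∀-bool? : {P : Bool → Set} → (∀ b → Dec (P b)) → Dec (∀ b → P b)
    ∀-bool? P? = map′ (λ { (p , q) false → p ; (p , q) true → q })
                      (λ all → all false , all true)
                      (P? false ×-dec P? true)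

    Adj? : ∀ u v → Dec (Adj n u v)
    Adj? (inj₁ i) (inj₁ _) = no λ ()
    Adj? (inj₁ i) (inj₂ j) = ¬? ((toℕ i ≟ toℕ j) ×-dec (toℕ i <? 2))
    Adj? (inj₂ j) (inj₁ i) = ¬? ((toℕ i ≟ toℕ j) ×-dec (toℕ i <? 2))
    Adj? (inj₂ _) (inj₂ _) = no λ ()

    _≟ₛ_ : (s t : V × V × Bool) → Dec (s ≡ t)
    _≟ₛ_ = Product.≡-dec _≟ᵛ_ (Product.≡-dec _≟ᵛ_ Bool._≟_)

    -- the successor of x in the cyclic list xs (junk when x does not occur)
    successor : List V → V → V
    successor []       x = x
    successor (y ∷ ys) x = go (y ∷ ys)
      where
      go : List V → V
      go []           = x
      go (z ∷ [])     = y
      go (z ∷ z′ ∷ zs) = if does (z ≟ᵛ x) then z′ else go (z′ ∷ zs)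

  pattern a  = inj₁ zero
  pattern b  = inj₁ (suc zero)
  pattern c  = inj₁ (suc (suc zero))
  pattern u₀ = inj₂ zero
  pattern u₁ = inj₂ (suc zero)
  pattern d₀ = inj₂ (suc (suc zero))
  pattern d₁ = inj₂ (suc (suc (suc zero)))

  open Decide {2}

  around : V → List V
  around a  = d₀ ∷ u₁ ∷ d₁ ∷ []
  around b  = u₀ ∷ d₀ ∷ d₁ ∷ []
  around c  = u₀ ∷ d₀ ∷ u₁ ∷ d₁ ∷ []
  around u₀ = b ∷ c ∷ []
  around u₁ = a ∷ c ∷ []
  around _  = a ∷ b ∷ c ∷ []

  twisted : V → V → Bool
  twisted a d₁ = true
  twisted b d₁ = true
  twisted c u₀ = true
  twisted c d₀ = true
  twisted c u₁ = true
  twisted _ _  = false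

  R₂ : RotSys V (Adj 2)
  R₂ = record
    { rot = rot ; rot⁻ = rot⁻ ; sig = sig
    ; rot-adj = from-yes (∀-vertex? λ u → ∀-vertex? λ v → Adj? u v →-dec Adj? u (rot u v))
    ; rot⁻-adj = from-yes (∀-vertex? λ u → ∀-vertex? λ v → Adj? u v →-dec Adj? u (rot⁻ u v))
    ; rot-rot⁻ = from-yes (∀-vertex? λ u → ∀-vertex? λ v → Adj? u v →-dec rot u (rot⁻ u v) ≟ᵛ v)
    ; rot⁻-rot = from-yes (∀-vertex? λ u → ∀-vertex? λ v → Adj? u v →-dec rot⁻ u (rot u v) ≟ᵛ v)
    ; rot-cyclic = λ u v w e e′ →
        let (i , eq) = from-yes (∀-vertex? λ u → ∀-vertex? λ v → ∀-vertex? λ w →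
                         Adj? u v →-dec Adj? u w →-dec any? λ (i : Fin 4) → iter (rot u) (toℕ i) v ≟ᵛ w) u v w e e′
        in toℕ i , eq
    ; sig-sym = from-yes (∀-vertex? λ u → ∀-vertex? λ v → Adj? u v →-dec sig u v Bool.≟ sig v u)
    }
    where
    rot rot⁻ : V → V → V
    rot  u = successor (around u)
    rot⁻ u = successor (List.reverse (around u))

    sig : V → V → Bool
    sig u v = twisted u v ∨ twisted v u

  open RotSys R₂ using (faceStep)

  quadrangular₂ : RotSys.Quadrangular R₂
  quadrangular₂ u v ε e =
    let (back , one , two) = from-yes (∀-vertex? λ u → ∀-vertex? λ v → ∀-bool? λ ε → Adj? u v →-dec
                               (iter faceStep 4 (u , v , ε) ≟ₛ (u , v , ε) ×-dec
                                ¬? (faceStep (u , v , ε) ≟ₛ (u , v , ε)) ×-dec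
                                ¬? (iter faceStep 2 (u , v , ε) ≟ₛ (u , v , ε)))) u v ε e
    in FaceTracing.quadrangularAt R₂ (Adj-sym 2) back one two

  embedding₂ : (h : 2 ≤ 2) → Σ (RotSys (Vtx 2) (Adj 2)) λ R →
    RotSys.Quadrangular R × SeparatedBy R (white 2 (# 2)) (unsatBlack₀ 2 h) (unsatBlack₁ 2 h) 1
  embedding₂ h = R₂ , quadrangular₂ , inj₁ refl

odd-view : ∀ p → (∀ k → ¬ (p ≡ 2 * k)) → ∃ λ k → p ≡ suc (k + k)
odd-view zero          p-odd = ⊥-elim (p-odd 0 refl)
odd-view (suc zero)    _     = 0 , refl
odd-view (suc (suc p)) p-odd
  with odd-view p (λ k e → p-odd (suc k) (trans (cong (λ z → suc (suc z)) e) (sym (*-suc 2 k))))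
... | k , e = suc k , cong (λ z → suc (suc z)) (trans e (sym (+-suc k k)))

odd-bound : ∀ k M → suc (k + k) < 2 * suc (suc M) ∸ 2 → k ≤ M
odd-bound k M lt with k ≤? M
... | yes le  = le
... | no  k≰M = ⊥-elim (<⇒≱ lt′ (≤-trans (+-mono-≤ (≰⇒> k≰M) (≰⇒> k≰M)) (n≤1+n _)))
  where
  lt′ : suc (k + k) < suc M + suc M
  lt′ = subst (suc (k + k) <_) (trans (cong (M +_) (+-identityʳ (suc (suc M)))) (+-suc M (suc M))) lt

lemma1 : ∀ (n p : ℕ) → (h : 2 ≤ n) → (∀ k → ¬ (p ≡ 2 * k)) → p < 2 * n ∸ 2 →
    Σ (RotSys (Vtx n) (Adj n)) λ R →
      RotSys.Quadrangular R ×
      SeparatedBy R (white n (# 2)) (unsatBlack₀ n h) (unsatBlack₁ n h) p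
lemma1 (suc (suc _)) p h p-odd p< with odd-view p p-odd
lemma1 (suc (suc zero))    _ h _ _                | zero  , refl = Smallest.embedding₂ h
lemma1 (suc (suc zero))    _ h _ (s≤s (s≤s ()))   | suc _ , refl
lemma1 (suc (suc (suc m))) _ h _ p<               | k     , refl = Embedding.embedding m k (odd-bound k (suc m) p<) h
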